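{- Let $k$ and $M$ be positive integers, and let $M=p_{1}^{e_{1}}p_{2}^{e_{2}}\cdots p_{l}^{e_{l}}$ be the prime factorization of $M$, where $p_1,\dots,p_l$ are distinct primes. For any integer $n\geq \max\{e_j \mid 1\leq j\leq l\}$, \[ \sum_{i=0}^{\varphi(M)-1}L(k,n+i)\equiv \sum_{i=0}^{\varphi(M)-1}L(n+i,k)\equiv 0\pmod{M}. \]
   Context: A matrix with all entries in $\{0,1\}$ is called lonesum if it is uniquely determined (among $0$-$1$ matrices of the same size) by its vector of row sums and its vector of column sums. For positive integers $k,n$, $L(k,n)$ denotes the number of lonesum matrices of size $k\times n$. $\varphi$ denotes Euler's totient function. -}

module Defs where

open import Data.Bool using (Bool; true; false; if_then_else_)
open import Data.Bool.Properties using () renaming (_≟_ to _≟ᵇ_)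
open import Data.Nat using (ℕ; zero; suc; _+_)
open import Data.Nat.Properties using () renaming (_≟_ to _≟ℕ_)
open import Data.Nat.GCD using (gcd)
open import Data.Vec as Vec using (Vec; []; _∷_; transpose)
open import Data.Vec.Properties using (≡-dec)
open import Data.List as List using (List; []; _∷_; length; filter; cartesianProductWith; upTo)
open import Data.List.Membership.Propositional using (_∈_)
open import Data.List.Membership.Propositional.Properties using (∈-cartesianProductWith⁺)
open import Data.List.Relation.Unary.Any using (here)
open import Data.List.Relation.Unary.All as All using (All; all?)
open import Relation.Nullary using (Dec; yes; no; ¬_)
open import Relation.Nullary.Decidable using (_→-dec_)
open import Relation.Binary.PropositionalEquality using (_≡_; refl)

Matrix01 : ℕ → ℕ → Set
Matrix01 k n = Vec (Vec Bool n) k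

bit : Bool → ℕ
bit b = if b then 1 else 0

vsum : ∀ {n} → Vec Bool n → ℕ
vsum xs = Vec.sum (Vec.map bit xs)

rowSums : ∀ {k n} → Matrix01 k n → Vec ℕ k
rowSums A = Vec.map vsum A

colSums : ∀ {k n} → Matrix01 k n → Vec ℕ n
colSums A = Vec.map vsum (transpose A)

Lonesum : ∀ {k n} → Matrix01 k n → Set
Lonesum {k} {n} A = ∀ (B : Matrix01 k n) → rowSums B ≡ rowSums A → colSums B ≡ colSums A → B ≡ A

vecs : ∀ {a} {A : Set a} → List A → (n : ℕ) → List (Vec A n)
vecs xs zero = [] ∷ []
vecs xs (suc n) = cartesianProductWith _∷_ xs (vecs xs n)

vecs-complete : ∀ {a} {A : Set a} (xs : List A) → (∀ x → x ∈ xs) → ∀ n (v : Vec A n) → v ∈ vecs xs n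
vecs-complete xs c zero [] = here refl
vecs-complete xs c (suc n) (x ∷ v) = ∈-cartesianProductWith⁺ _∷_ (c x) (vecs-complete xs c n v)

bools : List Bool
bools = false ∷ true ∷ []

bools-complete : ∀ b → b ∈ bools
bools-complete false = here refl
bools-complete true = Data.List.Relation.Unary.Any.there (here refl)

allMatrices : (k n : ℕ) → List (Matrix01 k n)
allMatrices k n = vecs (vecs bools n) k

allMatrices-complete : ∀ k n (A : Matrix01 k n) → A ∈ allMatrices k n
allMatrices-complete k n A = vecs-complete (vecs bools n) (vecs-complete bools bools-complete n) k A

lonesum? : ∀ {k n} (A : Matrix01 k n) → Dec (Lonesum A)
lonesum? {k} {n} A with all? (λ B → ≡-dec _≟ℕ_ (rowSums B) (rowSums A) →-dec
                                 (≡-dec _≟ℕ_ (colSums B) (colSums A) →-dec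
                                  ≡-dec (≡-dec _≟ᵇ_) B A)) (allMatrices k n)
... | yes p = yes (λ B → All.lookup p (allMatrices-complete k n B))
... | no ¬p = no (λ h → ¬p (All.tabulate (λ {B} _ → h B)))

L : ℕ → ℕ → ℕ
L k n = length (filter lonesum? (allMatrices k n))

-- Euler's totient: #{ i ∈ [0, M) : gcd(i, M) = 1 }  (equals #{1 ≤ i ≤ M : gcd(i,M)=1} for M ≥ 1).
φ : ℕ → ℕ
φ M = length (filter (λ i → gcd i M ≟ℕ 1) (upTo M))

Σ< : ℕ → (ℕ → ℕ) → ℕ
Σ< zero f = 0
Σ< (suc m) f = Σ< m f + f m

{-# OPTIONS --safe #-}
-- Lonesum matrices are exactly the threshold matrices, with entry (i , j) equal to [c ≤ F i + H j],
-- and each has a unique canonical representation: F maps onto [0, c) and H maps into [0, c] onto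
-- [1, c).  Counting canonical representations gives L(k, n) = Σ_{r<k} G₀(r+1, k) G₁(r, n), where
-- G₀(c, k), the number of surjections [k] → [c], is divisible by c!, and G₁(r, n) counts the
-- vectors in [0, r + 2)^n taking every value in [1, r].  Inverting Σ_j C(r, j) G₁(j, n) = (r + 2)^n
-- writes (r + 1)! G₁(r, ·) as an integer combination of the sequences (j + 1)(j + 2)^n, whose sums
-- over φ(M) consecutive indices telescope to (j + 2)^(n + φ(M)) - (j + 2)^n.  M divides these once
-- n bounds the exponents of M, by Euler's theorem applied to the part of M coprime to j + 2.
-- The second congruence follows from the first, since L(k, n) = L(n, k) by transposition.
module Submission where

open import Defs
import Algebra.Properties.CommutativeSemigroup as CommutativeSemigroupProperties
open import Data.Bool using (Bool; true; false)
open import Data.Bool.Properties using (T-≡) renaming (_≟_ to _≟ᵇ_)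
open import Data.Empty using (⊥-elim)
open import Data.Fin using (Fin; zero; suc)
open import Data.Fin.Properties using (any?) renaming (_≟_ to _≟ᶠ_)
open import Data.List as List using (List; []; _∷_; _++_; length; filter; upTo; cartesianProductWith)
open import Data.List.Properties using (length-++; length-map; length-upTo)
open import Data.List.Membership.Propositional using (_∈_)
open import Data.List.Membership.Propositional.Properties
open import Data.List.Membership.Propositional.Properties.WithK using (unique∧set⇒bag)
import Data.List.Membership.DecPropositional as DecMembership
open import Data.List.Relation.Binary.BagAndSetEquality using (∼bag⇒↭)
open import Data.List.Relation.Binary.Permutation.Propositional.Properties using (↭-length)
import Data.List.Relation.Unary.All as All
open import Data.List.Relation.Unary.AllPairs using ([]; _∷_)
open import Data.List.Relation.Unary.Any using (here; there)
open import Data.List.Relation.Unary.Unique.Propositional using (Unique)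
import Data.List.Relation.Unary.Unique.Propositional.Properties as Unique
open import Data.Nat
open import Data.Nat.Combinatorics using (_C_; nCk+nC[k+1]≡[n+1]C[k+1]; nCn≡1; nC1≡n)
open import Data.Nat.Combinatorics.Specification using (k>n⇒nCk≡0)
open import Data.Nat.Coprimality as Coprimality using (Coprime; coprime-divisor; gcd≡1⇒coprime; coprime⇒gcd≡1)
open import Data.Nat.Divisibility
open import Data.Nat.DivMod
open import Data.Nat.GCD
open import Data.Nat.Induction using (<-rec)
open import Data.Nat.ListAction using (product)
open import Data.Nat.ListAction.Properties using (product-↭)
open import Data.Nat.Primality using (Prime)
open import Data.Nat.Primality.Factorisation using (factorise)
open import Data.Nat.Properties
open import Data.Nat.Tactic.RingSolver using (solve-∀)
open import Data.Product using (∃; _×_; _,_; proj₁; proj₂)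
open import Data.Sum using (_⊎_; inj₁; inj₂)
open import Data.Vec as Vec using (Vec; []; _∷_; lookup; _⊛_; replicate; zipWith; transpose; _[_]≔_)
open import Data.Vec.Properties
  using (lookup-map; lookup-zipWith; ∷-injective; tabulate∘lookup; tabulate-cong; lookup∘update; lookup∘update′;
         map-[]≔; []≔-lookup; lookup-replicate; lookup-⊛; map-∘; map-cong; ≡-dec)
open import Function.Bundles using (Equivalence; _⇔_; mk⇔)
open import Relation.Binary.Definitions using (DecidableEquality; tri<; tri≈; tri>)
open import Relation.Binary.PropositionalEquality
open import Relation.Nullary using (¬_; yes; no; ¬?)
open import Relation.Nullary.Decidable using (_×-dec_; decidable-stable)

module +-CS = CommutativeSemigroupProperties +-commutativeSemigroup
module *-CS = CommutativeSemigroupProperties *-commutativeSemigroup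

-- Coverings

length-cartesianProductWith : ∀ {A B C : Set} (f : A → B → C) xs ys →
  length (cartesianProductWith f xs ys) ≡ length xs * length ys
length-cartesianProductWith f [] ys = refl
length-cartesianProductWith f (x ∷ xs) ys = begin
  length (List.map (f x) ys ++ cartesianProductWith f xs ys)
    ≡⟨ length-++ (List.map (f x) ys) ⟩
  length (List.map (f x) ys) + length (cartesianProductWith f xs ys)
    ≡⟨ cong₂ _+_ (length-map (f x) ys) (length-cartesianProductWith f xs ys) ⟩
  length ys + length xs * length ys ∎
  where open ≡-Reasoning

punchIn : ℕ → ℕ → ℕ
punchIn p v with v <? p
... | yes _ = v
... | no _ = suc v

punchOut : ℕ → ℕ → ℕ
punchOut p v with v <? p
... | yes _ = v
... | no _ = pred v

punchIn-< : ∀ {p v} → v < p → punchIn p v ≡ v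
punchIn-< {p} {v} v<p with v <? p
... | yes _ = refl
... | no v≮p = ⊥-elim (v≮p v<p)

punchIn-≥ : ∀ {p v} → p ≤ v → punchIn p v ≡ suc v
punchIn-≥ {p} {v} p≤v with v <? p
... | yes v<p = ⊥-elim (<⇒≱ v<p p≤v)
... | no _ = refl

punchIn-≤ : ∀ p v → punchIn p v ≤ suc v
punchIn-≤ p v with v <? p
... | yes _ = n≤1+n v
... | no _ = ≤-refl

punchIn-≢ : ∀ p v → punchIn p v ≢ p
punchIn-≢ p v with v <? p
... | yes v<p = λ v≡p → <-irrefl v≡p v<p
... | no v≮p = λ 1+v≡p → v≮p (≤-reflexive 1+v≡p)

punchIn-injective : ∀ p {u v} → punchIn p u ≡ punchIn p v → u ≡ v
punchIn-injective p {u} {v} eq with u <? p | v <? p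
... | yes _ | yes _ = eq
... | yes u<p | no v≮p = ⊥-elim (v≮p (<-trans (n<1+n v) (subst (_< p) eq u<p)))
... | no u≮p | yes v<p = ⊥-elim (u≮p (<-trans (n<1+n u) (subst (_< p) (sym eq) v<p)))
... | no _ | no _ = suc-injective eq

punchOut-< : ∀ {p v} → v < p → punchOut p v ≡ v
punchOut-< {p} {v} v<p with v <? p
... | yes _ = refl
... | no v≮p = ⊥-elim (v≮p v<p)

punchOut-≥ : ∀ {p v} → p ≤ v → punchOut p (suc v) ≡ v
punchOut-≥ {p} {v} p≤v with suc v <? p
... | yes 1+v<p = ⊥-elim (<⇒≱ 1+v<p (≤-trans p≤v (n≤1+n v)))
... | no _ = refl

punchIn-punchOut : ∀ {p v} → v ≢ p → punchIn p (punchOut p v) ≡ v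
punchIn-punchOut {p} {v} v≢p with v <? p
... | yes v<p = punchIn-< v<p
punchIn-punchOut {p} {zero} 0≢p | no 0≮p = ⊥-elim (0≢p (sym (n≤0⇒n≡0 (≮⇒≥ 0≮p))))
punchIn-punchOut {p} {suc v} 1+v≢p | no 1+v≮p =
  punchIn-≥ (≤-pred (≤∧≢⇒< (≮⇒≥ 1+v≮p) (λ p≡1+v → 1+v≢p (sym p≡1+v))))

record Covers {k} (bound lo hi : ℕ) (H : Vec ℕ k) : Set where
  constructor mkCovers
  field
    bounded : ∀ j → lookup H j < bound
    onto    : ∀ t → lo ≤ t → t < hi → ∃ λ j → lookup H j ≡ t
open Covers

freshHead : ∀ {k} → ℕ → Vec ℕ k → Vec ℕ (suc k)
freshHead p H = p ∷ Vec.map (punchIn p) H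

-- The vectors of length k with entries in [0, a + b + r) taking every value in [a, a + r).  Either
-- the head is irrelevant for covering, or it is the only occurrence of its value in [a, a + r) and
-- punching it out of the tail leaves a covering of an interval one shorter.
mutual
  coverings : (a b r k : ℕ) → List (Vec ℕ k)
  coverings a b r       (suc k) =
    cartesianProductWith Vec._∷_ (upTo (a + b + r)) (coverings a b r k) ++ freshHeadCoverings a b r k
  coverings a b zero    zero    = [] ∷ []
  coverings a b (suc r) zero    = []

  freshHeadCoverings : (a b r k : ℕ) → List (Vec ℕ (suc k))
  freshHeadCoverings a b zero    k = []
  freshHeadCoverings a b (suc r) k =
    cartesianProductWith freshHead (List.map (a +_) (upTo (suc r))) (coverings a b r k)

mutual
  coverCount : (a b r k : ℕ) → ℕ
  coverCount a b r       (suc k) = (a + b + r) * coverCount a b r k + freshHeadCount a b r k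
  coverCount a b zero    zero    = 1
  coverCount a b (suc r) zero    = 0

  freshHeadCount : (a b r k : ℕ) → ℕ
  freshHeadCount a b zero    k = 0
  freshHeadCount a b (suc r) k = suc r * coverCount a b r k

mutual
  length-coverings : ∀ a b r k → length (coverings a b r k) ≡ coverCount a b r k
  length-coverings a b r (suc k) = begin
    length (cartesianProductWith Vec._∷_ (upTo (a + b + r)) (coverings a b r k) ++ freshHeadCoverings a b r k)
      ≡⟨ length-++ (cartesianProductWith Vec._∷_ (upTo (a + b + r)) (coverings a b r k)) ⟩
    length (cartesianProductWith Vec._∷_ (upTo (a + b + r)) (coverings a b r k)) + length (freshHeadCoverings a b r k)
      ≡⟨ cong₂ _+_ (length-cartesianProductWith Vec._∷_ (upTo (a + b + r)) (coverings a b r k))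
                   (length-freshHeadCoverings a b r k) ⟩
    length (upTo (a + b + r)) * length (coverings a b r k) + freshHeadCount a b r k
      ≡⟨ cong (_+ freshHeadCount a b r k) (cong₂ _*_ (length-upTo (a + b + r)) (length-coverings a b r k)) ⟩
    (a + b + r) * coverCount a b r k + freshHeadCount a b r k ∎
    where open ≡-Reasoning
  length-coverings a b zero    zero = refl
  length-coverings a b (suc r) zero = refl

  length-freshHeadCoverings : ∀ a b r k → length (freshHeadCoverings a b r k) ≡ freshHeadCount a b r k
  length-freshHeadCoverings a b zero    k = refl
  length-freshHeadCoverings a b (suc r) k = begin
    length (freshHeadCoverings a b (suc r) k)
      ≡⟨ length-cartesianProductWith freshHead (List.map (a +_) (upTo (suc r))) (coverings a b r k) ⟩
    length (List.map (a +_) (upTo (suc r))) * length (coverings a b r k)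
      ≡⟨ cong₂ _*_ (trans (length-map (a +_) (upTo (suc r))) (length-upTo (suc r))) (length-coverings a b r k) ⟩
    suc r * coverCount a b r k ∎
    where open ≡-Reasoning

∷-covers : ∀ {k bound lo hi t} {H : Vec ℕ k} → t < bound → Covers bound lo hi H → Covers bound lo hi (t ∷ H)
∷-covers {bound = bound} {lo} {hi} {t} {H} t<bound cov = mkCovers bounded′ onto′
  where
  bounded′ : ∀ j → lookup (t ∷ H) j < bound
  bounded′ zero = t<bound
  bounded′ (suc j) = bounded cov j
  onto′ : ∀ s → lo ≤ s → s < hi → ∃ λ j → lookup (t ∷ H) j ≡ s
  onto′ s lo≤s s<hi with onto cov s lo≤s s<hi
  ... | j , eq = suc j , eq

punchIn-covers : ∀ {k bound lo hi p} {H : Vec ℕ k} → lo ≤ p → p ≤ hi → hi ≤ bound →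
  Covers bound lo hi H → Covers (suc bound) lo (suc hi) (freshHead p H)
punchIn-covers {bound = bound} {lo} {hi} {p} {H} lo≤p p≤hi hi≤bound cov = mkCovers bounded′ onto′
  where
  bounded′ : ∀ j → lookup (p ∷ Vec.map (punchIn p) H) j < suc bound
  bounded′ zero = s≤s (≤-trans p≤hi hi≤bound)
  bounded′ (suc j) rewrite lookup-map j (punchIn p) H =
    s≤s (≤-trans (punchIn-≤ p (lookup H j)) (bounded cov j))
  onto′ : ∀ t → lo ≤ t → t < suc hi → ∃ λ j → lookup (p ∷ Vec.map (punchIn p) H) j ≡ t
  onto′ t lo≤t t<1+hi with <-cmp t p
  ... | tri≈ _ t≡p _ = zero , sym t≡p
  ... | tri< t<p _ _ with onto cov t lo≤t (<-≤-trans t<p p≤hi)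
  ...   | j , eq = suc j , trans (lookup-map j (punchIn p) H) (trans (cong (punchIn p) eq) (punchIn-< t<p))
  onto′ (suc t) lo≤t t<1+hi | tri> _ _ p<1+t with onto cov t (≤-trans lo≤p (≤-pred p<1+t)) (≤-pred t<1+hi)
  ...   | j , eq = suc j , trans (lookup-map j (punchIn p) H) (trans (cong (punchIn p) eq) (punchIn-≥ (≤-pred p<1+t)))

punchOut-covers : ∀ {k bound lo hi p} {H : Vec ℕ k} → p ≤ hi → hi ≤ bound → (∀ j → lookup H j ≢ p) →
  Covers (suc bound) lo (suc hi) (p ∷ H) → Covers bound lo hi (Vec.map (punchOut p) H)
punchOut-covers {bound = bound} {lo} {hi} {p} {H} p≤hi hi≤bound p∉H cov = mkCovers bounded′ onto′
  where
  bounded′ : ∀ j → lookup (Vec.map (punchOut p) H) j < bound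
  bounded′ j rewrite lookup-map j (punchOut p) H with <-cmp (lookup H j) p | bounded cov (suc j)
  ... | tri< h<p _ _ | _ rewrite punchOut-< h<p = <-≤-trans h<p (≤-trans p≤hi hi≤bound)
  ... | tri≈ _ h≡p _ | _ = ⊥-elim (p∉H j h≡p)
  ... | tri> _ _ p<h | h<1+bound with lookup H j
  ...   | suc h rewrite punchOut-≥ {p} {h} (≤-pred p<h) = ≤-pred h<1+bound
  onto′ : ∀ s → lo ≤ s → s < hi → ∃ λ j → lookup (Vec.map (punchOut p) H) j ≡ s
  onto′ s lo≤s s<hi with s <? p
  ... | yes s<p with onto cov s lo≤s (<-trans s<hi (n<1+n hi))
  ...   | zero , p≡s = ⊥-elim (<-irrefl (sym p≡s) s<p)
  ...   | suc j , eq = j , trans (lookup-map j (punchOut p) H) (trans (cong (punchOut p) eq) (punchOut-< s<p))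
  onto′ s lo≤s s<hi | no s≮p with onto cov (suc s) (≤-trans lo≤s (n≤1+n s)) (s≤s s<hi)
  ...   | zero , p≡1+s = ⊥-elim (s≮p (≤-reflexive (sym p≡1+s)))
  ...   | suc j , eq = j , trans (lookup-map j (punchOut p) H) (trans (cong (punchOut p) eq) (punchOut-≥ (≮⇒≥ s≮p)))

tail-covers : ∀ {k bound lo hi t} {H : Vec ℕ k} → Covers bound lo hi (t ∷ H) →
  (lo ≤ t → t < hi → ∃ λ j → lookup H j ≡ t) → Covers bound lo hi H
tail-covers {lo = lo} {hi} {t} {H} cov t∈H = mkCovers (λ j → bounded cov (suc j)) onto′
  where
  onto′ : ∀ s → lo ≤ s → s < hi → ∃ λ j → lookup H j ≡ s
  onto′ s lo≤s s<hi with onto cov s lo≤s s<hi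
  ... | zero , refl = t∈H lo≤s s<hi
  ... | suc j , eq = j , eq

head-fresh-or-tail-covers : ∀ {k bound lo hi t} {H : Vec ℕ k} → Covers bound lo hi (t ∷ H) →
  Covers bound lo hi H ⊎ (lo ≤ t × t < hi × ∀ j → lookup H j ≢ t)
head-fresh-or-tail-covers {lo = lo} {hi} {t} {H} cov with any? (λ j → lookup H j ≟ t) | lo ≤? t | t <? hi
... | no t∉H | yes lo≤t | yes t<hi = inj₂ (lo≤t , t<hi , λ j eq → t∉H (j , eq))
... | yes t∈H | _ | _ = inj₁ (tail-covers cov (λ _ _ → t∈H))
... | no _ | no lo≰t | _ = inj₁ (tail-covers cov (λ lo≤t _ → ⊥-elim (lo≰t lo≤t)))
... | no _ | yes _ | no t≮hi = inj₁ (tail-covers cov (λ _ t<hi → ⊥-elim (t≮hi t<hi)))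

∈-freshHeadCoverings⁻ : ∀ a b r k {H} → H ∈ freshHeadCoverings a b (suc r) k →
  ∃ λ s → ∃ λ H′ → s < suc r × H′ ∈ coverings a b r k × H ≡ freshHead (a + s) H′
∈-freshHeadCoverings⁻ a b r k H∈
  with ∈-cartesianProductWith⁻ freshHead (List.map (a +_) (upTo (suc r))) (coverings a b r k) H∈
... | p , H′ , p∈ , H′∈ , refl with ∈-map⁻ (a +_) p∈
...   | s , s∈ , refl = s , H′ , ∈-upTo⁻ s∈ , H′∈ , refl

∈-freshHeadCoverings⁺ : ∀ a b r k {p H} → a ≤ p → p < a + suc r → H ∈ coverings a b r k →
  freshHead p H ∈ freshHeadCoverings a b (suc r) k
∈-freshHeadCoverings⁺ a b r k {p} a≤p p<a+1+r H∈ =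
  subst (λ q → freshHead q _ ∈ freshHeadCoverings a b (suc r) k) (m+[n∸m]≡n a≤p)
  (∈-cartesianProductWith⁺ freshHead (∈-map⁺ (a +_) (∈-upTo⁺ (+-cancelˡ-< a (p ∸ a) (suc r) p-a<1+r))) H∈)
  where
  p-a<1+r : a + (p ∸ a) < a + suc r
  p-a<1+r = subst (_< a + suc r) (sym (m+[n∸m]≡n a≤p)) p<a+1+r

coverings-sound : ∀ a b r k {H} → H ∈ coverings a b r k → Covers (a + b + r) a (a + r) H
coverings-sound a b zero zero (here refl) =
  mkCovers (λ ()) (λ t a≤t t<a+0 → ⊥-elim (<⇒≱ t<a+0 (subst (_≤ t) (sym (+-identityʳ a)) a≤t)))
coverings-sound a b r (suc k) H∈ with ∈-++⁻ (cartesianProductWith Vec._∷_ (upTo (a + b + r)) (coverings a b r k)) H∈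
... | inj₁ H∈₁ with ∈-cartesianProductWith⁻ Vec._∷_ (upTo (a + b + r)) (coverings a b r k) H∈₁
...   | t , H′ , t∈ , H′∈ , refl = ∷-covers (∈-upTo⁻ t∈) (coverings-sound a b r k H′∈)
coverings-sound a b (suc r) (suc k) H∈ | inj₂ H∈₂ with ∈-freshHeadCoverings⁻ a b r k H∈₂
...   | s , H′ , s<1+r , H′∈ , refl =
  subst₂ (λ bound hi → Covers bound a hi (freshHead (a + s) H′)) (sym (+-suc (a + b) r)) (sym (+-suc a r))
    (punchIn-covers (m≤m+n a s) (+-monoʳ-≤ a (≤-pred s<1+r)) (+-monoˡ-≤ r (m≤m+n a b)) (coverings-sound a b r k H′∈))

map-punchIn-punchOut : ∀ {k} p (H : Vec ℕ k) → (∀ j → lookup H j ≢ p) → Vec.map (punchIn p) (Vec.map (punchOut p) H) ≡ H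
map-punchIn-punchOut p [] p∉H = refl
map-punchIn-punchOut p (h ∷ H) p∉H =
  cong₂ Vec._∷_ (punchIn-punchOut (p∉H zero)) (map-punchIn-punchOut p H (λ j → p∉H (suc j)))

coverings-complete : ∀ a b r k (H : Vec ℕ k) → Covers (a + b + r) a (a + r) H → H ∈ coverings a b r k
coverings-complete a b zero zero [] cov = here refl
coverings-complete a b (suc r) zero [] cov with onto cov a ≤-refl (subst (a <_) (sym (+-suc a r)) (s≤s (m≤m+n a r)))
... | () , _
coverings-complete a b r (suc k) (t ∷ H) cov with head-fresh-or-tail-covers cov
... | inj₁ covH = ∈-++⁺ˡ (∈-cartesianProductWith⁺ Vec._∷_ (∈-upTo⁺ (bounded cov zero)) (coverings-complete a b r k H covH))
... | inj₂ (a≤t , t<a+r , t∉H) = ∈-++⁺ʳ _ (fresh r t<a+r cov)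
  where
  fresh : ∀ r → t < a + r → Covers (a + b + r) a (a + r) (t ∷ H) → (t ∷ H) ∈ freshHeadCoverings a b r k
  fresh zero t<a+0 _ = ⊥-elim (<⇒≱ t<a+0 (subst (_≤ t) (sym (+-identityʳ a)) a≤t))
  fresh (suc r) t<a+1+r cov′ = subst (λ H′ → (t ∷ H′) ∈ freshHeadCoverings a b (suc r) k) (map-punchIn-punchOut t H t∉H)
    (∈-freshHeadCoverings⁺ a b r k a≤t t<a+1+r (coverings-complete a b r k _
      (punchOut-covers t≤a+r (+-monoˡ-≤ r (m≤m+n a b)) t∉H
        (subst₂ (λ bound hi → Covers bound a hi (t ∷ H)) (+-suc (a + b) r) (+-suc a r) cov′))))
    where
    t≤a+r : t ≤ a + r
    t≤a+r = ≤-pred (subst (t <_) (+-suc a r) t<a+1+r)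

freshHead-injective : ∀ {k p q} {H H′ : Vec ℕ k} → freshHead p H ≡ freshHead q H′ → p ≡ q × H ≡ H′
freshHead-injective {p = p} {H = H} {H′} eq with ∷-injective eq
... | refl , tail-eq = refl , map-injective tail-eq
  where
  map-injective : ∀ {k} {H H′ : Vec ℕ k} → Vec.map (punchIn p) H ≡ Vec.map (punchIn p) H′ → H ≡ H′
  map-injective {H = []} {[]} _ = refl
  map-injective {H = h ∷ H} {h′ ∷ H′} eq′ with ∷-injective eq′
  ... | h-eq , t-eq = cong₂ Vec._∷_ (punchIn-injective p h-eq) (map-injective t-eq)

headCoverings-freshHeadCoverings-disjoint : ∀ a b r k {H} →
  H ∈ cartesianProductWith Vec._∷_ (upTo (a + b + r)) (coverings a b r k) → ¬ H ∈ freshHeadCoverings a b r k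
headCoverings-freshHeadCoverings-disjoint a b (suc r) k H∈₁ H∈₂
  with ∈-cartesianProductWith⁻ Vec._∷_ (upTo (a + b + suc r)) (coverings a b (suc r) k) H∈₁
... | t , H′ , _ , H′∈ , refl with ∈-freshHeadCoverings⁻ a b r k H∈₂
...   | s , H″ , s<1+r , _ , refl with onto (coverings-sound a b (suc r) k H′∈) (a + s) (m≤m+n a s) (+-monoʳ-< a s<1+r)
...     | j , eq = punchIn-≢ (a + s) (lookup H″ j) (trans (sym (lookup-map j (punchIn (a + s)) H″)) eq)

coverings-unique : ∀ a b r k → Unique (coverings a b r k)
coverings-unique a b r (suc k) = Unique.++⁺
  (Unique.cartesianProductWith⁺ Vec._∷_ ∷-injective (Unique.upTo⁺ (a + b + r)) (coverings-unique a b r k))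
  (fresh-unique r) (λ (H∈₁ , H∈₂) → headCoverings-freshHeadCoverings-disjoint a b r k H∈₁ H∈₂)
  where
  fresh-unique : ∀ r → Unique (freshHeadCoverings a b r k)
  fresh-unique zero = []
  fresh-unique (suc r) = Unique.cartesianProductWith⁺ freshHead freshHead-injective
    (Unique.map⁺ (+-cancelˡ-≡ a _ _) (Unique.upTo⁺ (suc r))) (coverings-unique a b r k)
coverings-unique a b zero zero = All.[] ∷ []
coverings-unique a b (suc r) zero = []

-- Threshold matrices

bits : ∀ {n} → Vec Bool n → Vec ℕ n
bits = Vec.map bit

colSums-∷ : ∀ {k n} (x : Vec Bool n) (X : Matrix01 k n) → colSums (x ∷ X) ≡ zipWith _+_ (bits x) (colSums X)
colSums-∷ x X = go x (transpose X)
  where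
  go : ∀ {n k} (x : Vec Bool n) (Y : Vec (Vec Bool k) n) →
       Vec.map vsum ((replicate n Vec._∷_ ⊛ x) ⊛ Y) ≡ zipWith _+_ (bits x) (Vec.map vsum Y)
  go [] [] = refl
  go (b ∷ x) (y ∷ Y) = cong (_ ∷_) (go x Y)

colSums-[] : ∀ n → colSums {0} {n} [] ≡ replicate n 0
colSums-[] zero = refl
colSums-[] (suc n) = cong (0 ∷_) (colSums-[] n)

lookup-colSums-∷ : ∀ {k n} (x : Vec Bool n) (X : Matrix01 k n) j →
  lookup (colSums (x ∷ X)) j ≡ bit (lookup x j) + lookup (colSums X) j
lookup-colSums-∷ x X j rewrite colSums-∷ x X | lookup-zipWith _+_ j (bits x) (colSums X) | lookup-map j bit x = refl

≤⇒≤ᵇ≡true : ∀ {m n} → m ≤ n → (m ≤ᵇ n) ≡ true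
≤⇒≤ᵇ≡true m≤n = Equivalence.to T-≡ (≤⇒≤ᵇ m≤n)

≤ᵇ≡true⇒≤ : ∀ {m n} → (m ≤ᵇ n) ≡ true → m ≤ n
≤ᵇ≡true⇒≤ {m} {n} eq = ≤ᵇ⇒≤ m n (Equivalence.from T-≡ eq)

≰⇒≤ᵇ≡false : ∀ {m n} → ¬ m ≤ n → (m ≤ᵇ n) ≡ false
≰⇒≤ᵇ≡false {m} {n} m≰n with m ≤ᵇ n in eq
... | false = refl
... | true = ⊥-elim (m≰n (≤ᵇ≡true⇒≤ eq))

≤ᵇ≡false⇒≰ : ∀ {m n} → (m ≤ᵇ n) ≡ false → ¬ m ≤ n
≤ᵇ≡false⇒≰ eq m≤n with trans (sym (≤⇒≤ᵇ≡true m≤n)) eq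
... | ()

thresholdRow : ℕ → ∀ {n} → Vec ℕ n → ℕ → Vec Bool n
thresholdRow c H f = Vec.map (λ h → c ≤ᵇ f + h) H

thresholdMatrix : ℕ → ∀ {k n} → Vec ℕ k → Vec ℕ n → Matrix01 k n
thresholdMatrix c F H = Vec.map (thresholdRow c H) F

lookup-thresholdRow : ∀ c {n} (H : Vec ℕ n) f j → lookup (thresholdRow c H f) j ≡ (c ≤ᵇ f + lookup H j)
lookup-thresholdRow c H f j = lookup-map j _ H

lookup-thresholdMatrix : ∀ c {k n} (F : Vec ℕ k) (H : Vec ℕ n) i j →
  lookup (lookup (thresholdMatrix c F H) i) j ≡ (c ≤ᵇ lookup F i + lookup H j)
lookup-thresholdMatrix c F H i j =
  trans (cong (λ row → lookup row j) (lookup-map i (thresholdRow c H) F)) (lookup-thresholdRow c H (lookup F i) j)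

-- A cell with F i + H j = s weighs 2 s + 1 when its entry is 1 and 2 c when it is 0.  The threshold
-- matrix is the unique heaviest matrix, while the total weight plus 2 c times the number of ones
-- depends only on the row and column sums (matrixWeight-identity).
weight : ℕ → ℕ → Bool → ℕ
weight c s true = suc (2 * s)
weight c s false = 2 * c

1+2*s<2*c : ∀ {s c} → s < c → suc (2 * s) < 2 * c
1+2*s<2*c {s} {c} s<c = subst (_≤ 2 * c) (*-suc 2 s) (*-monoʳ-≤ 2 s<c)

weight-max : ∀ c s b → weight c s b ≤ weight c s (c ≤ᵇ s)
weight-max c s b with c ≤? s
weight-max c s true | yes c≤s rewrite ≤⇒≤ᵇ≡true c≤s = ≤-refl
weight-max c s false | yes c≤s rewrite ≤⇒≤ᵇ≡true c≤s = ≤-trans (*-monoʳ-≤ 2 c≤s) (n≤1+n _)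
weight-max c s true | no c≰s rewrite ≰⇒≤ᵇ≡false c≰s = <⇒≤ (1+2*s<2*c (≰⇒> c≰s))
weight-max c s false | no c≰s rewrite ≰⇒≤ᵇ≡false c≰s = ≤-refl

weight-max-unique : ∀ c s b → weight c s b ≡ weight c s (c ≤ᵇ s) → b ≡ (c ≤ᵇ s)
weight-max-unique c s b eq with c ≤? s
weight-max-unique c s true eq | yes c≤s rewrite ≤⇒≤ᵇ≡true c≤s = refl
weight-max-unique c s false eq | yes c≤s rewrite ≤⇒≤ᵇ≡true c≤s = ⊥-elim (<-irrefl eq (s≤s (*-monoʳ-≤ 2 c≤s)))
weight-max-unique c s true eq | no c≰s rewrite ≰⇒≤ᵇ≡false c≰s = ⊥-elim (<-irrefl eq (1+2*s<2*c (≰⇒> c≰s)))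
weight-max-unique c s false eq | no c≰s rewrite ≰⇒≤ᵇ≡false c≰s = refl

weight-bit : ∀ c f h b → weight c (f + h) b + 2 * c * bit b ≡ 2 * f * bit b + 2 * (h * bit b) + bit b + 2 * c
weight-bit c f h true = by-ring c f h
  where
  by-ring : ∀ c f h → suc (2 * (f + h)) + 2 * c * 1 ≡ 2 * f * 1 + 2 * (h * 1) + 1 + 2 * c
  by-ring = solve-∀
weight-bit c f h false = by-ring c f h
  where
  by-ring : ∀ c f h → 2 * c + 2 * c * 0 ≡ 2 * f * 0 + 2 * (h * 0) + 0 + 2 * c
  by-ring = solve-∀

rowWeight : ℕ → ℕ → ∀ {n} → Vec ℕ n → Vec Bool n → ℕ
rowWeight c f [] [] = 0
rowWeight c f (h ∷ H) (b ∷ x) = weight c (f + h) b + rowWeight c f H x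

matrixWeight : ℕ → ∀ {k n} → Vec ℕ k → Vec ℕ n → Matrix01 k n → ℕ
matrixWeight c [] H [] = 0
matrixWeight c (f ∷ F) H (x ∷ X) = rowWeight c f H x + matrixWeight c F H X

dot : ∀ {n} → Vec ℕ n → Vec ℕ n → ℕ
dot [] [] = 0
dot (a ∷ u) (b ∷ v) = a * b + dot u v

dot-zipWith-+ : ∀ {n} (H u v : Vec ℕ n) → dot H (zipWith _+_ u v) ≡ dot H u + dot H v
dot-zipWith-+ [] [] [] = refl
dot-zipWith-+ (h ∷ H) (a ∷ u) (b ∷ v) rewrite dot-zipWith-+ H u v =
  trans (cong (_+ (dot H u + dot H v)) (*-distribˡ-+ h a b)) (+-CS.interchange (h * a) (h * b) (dot H u) (dot H v))

dot-replicate-0 : ∀ {n} (H : Vec ℕ n) → dot H (replicate n 0) ≡ 0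
dot-replicate-0 [] = refl
dot-replicate-0 (h ∷ H) rewrite dot-replicate-0 H | *-zeroʳ h = refl

rowWeight-identity : ∀ c f {n} (H : Vec ℕ n) (x : Vec Bool n) →
  rowWeight c f H x + 2 * c * vsum x ≡ 2 * f * vsum x + 2 * dot H (bits x) + vsum x + 2 * c * n
rowWeight-identity c f [] [] = by-ring c f
  where
  by-ring : ∀ c f → 0 + 2 * c * 0 ≡ 2 * f * 0 + 2 * 0 + 0 + 2 * c * 0
  by-ring = solve-∀
rowWeight-identity c f {suc n} (h ∷ H) (b ∷ x) = begin
  (weight c (f + h) b + rowWeight c f H x) + 2 * c * (bit b + vsum x)
    ≡⟨ regroup (weight c (f + h) b) (rowWeight c f H x) c (bit b) (vsum x) ⟩
  (weight c (f + h) b + 2 * c * bit b) + (rowWeight c f H x + 2 * c * vsum x)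
    ≡⟨ cong₂ _+_ (weight-bit c f h b) (rowWeight-identity c f H x) ⟩
  (2 * f * bit b + 2 * (h * bit b) + bit b + 2 * c) + (2 * f * vsum x + 2 * dot H (bits x) + vsum x + 2 * c * n)
    ≡⟨ collect f h (bit b) c (dot H (bits x)) (vsum x) n ⟩
  2 * f * (bit b + vsum x) + 2 * (h * bit b + dot H (bits x)) + (bit b + vsum x) + 2 * c * suc n ∎
  where
  open ≡-Reasoning
  regroup : ∀ p r c b v → (p + r) + 2 * c * (b + v) ≡ (p + 2 * c * b) + (r + 2 * c * v)
  regroup = solve-∀
  collect : ∀ f h b c d v n → (2 * f * b + 2 * (h * b) + b + 2 * c) + (2 * f * v + 2 * d + v + 2 * c * n)
     ≡ 2 * f * (b + v) + 2 * (h * b + d) + (b + v) + 2 * c * suc n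
  collect = solve-∀

matrixWeight-identity : ∀ c {k n} (F : Vec ℕ k) (H : Vec ℕ n) (X : Matrix01 k n) →
  matrixWeight c F H X + 2 * c * Vec.sum (rowSums X)
    ≡ 2 * dot F (rowSums X) + 2 * dot H (colSums X) + Vec.sum (rowSums X) + 2 * c * n * k
matrixWeight-identity c {n = n} [] H [] rewrite colSums-[] n | dot-replicate-0 H = by-ring c n
  where
  by-ring : ∀ c n → 0 + 2 * c * 0 ≡ 2 * 0 + 2 * 0 + 0 + 2 * c * n * 0
  by-ring = solve-∀
matrixWeight-identity c {suc k} {n} (f ∷ F) H (x ∷ X) = begin
  (rowWeight c f H x + matrixWeight c F H X) + 2 * c * (vsum x + Vec.sum (rowSums X))
    ≡⟨ regroup (rowWeight c f H x) (matrixWeight c F H X) c (vsum x) (Vec.sum (rowSums X)) ⟩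
  (rowWeight c f H x + 2 * c * vsum x) + (matrixWeight c F H X + 2 * c * Vec.sum (rowSums X))
    ≡⟨ cong₂ _+_ (rowWeight-identity c f H x) (matrixWeight-identity c F H X) ⟩
  (2 * f * vsum x + 2 * dot H (bits x) + vsum x + 2 * c * n)
    + (2 * dot F (rowSums X) + 2 * dot H (colSums X) + Vec.sum (rowSums X) + 2 * c * n * k)
    ≡⟨ collect f (vsum x) (dot H (bits x)) (dot F (rowSums X)) (dot H (colSums X)) (Vec.sum (rowSums X)) c n k ⟩
  2 * (f * vsum x + dot F (rowSums X)) + 2 * (dot H (bits x) + dot H (colSums X)) + (vsum x + Vec.sum (rowSums X)) + 2 * c * n * suc k
    ≡⟨ cong (λ z → 2 * (f * vsum x + dot F (rowSums X)) + 2 * z + (vsum x + Vec.sum (rowSums X)) + 2 * c * n * suc k)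
            (trans (sym (dot-zipWith-+ H (bits x) (colSums X))) (cong (dot H) (sym (colSums-∷ x X)))) ⟩
  2 * (f * vsum x + dot F (rowSums X)) + 2 * dot H (colSums (x ∷ X)) + (vsum x + Vec.sum (rowSums X)) + 2 * c * n * suc k ∎
  where
  open ≡-Reasoning
  regroup : ∀ p r c b v → (p + r) + 2 * c * (b + v) ≡ (p + 2 * c * b) + (r + 2 * c * v)
  regroup = solve-∀
  collect : ∀ f v d F e w c n k → (2 * f * v + 2 * d + v + 2 * c * n) + (2 * F + 2 * e + w + 2 * c * n * k)
    ≡ 2 * (f * v + F) + 2 * (d + e) + (v + w) + 2 * c * n * suc k
  collect = solve-∀

+-≤-≡-split : ∀ {a a′ b b′} → a ≤ a′ → b ≤ b′ → a + b ≡ a′ + b′ → a ≡ a′ × b ≡ b′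
+-≤-≡-split {a} {a′} {b} {b′} a≤a′ b≤b′ eq with ≤-antisym a≤a′ (≮⇒≥ λ a<a′ → <-irrefl eq (+-mono-<-≤ a<a′ b≤b′))
... | refl = refl , +-cancelˡ-≡ a b b′ eq

rowWeight-max : ∀ c f {n} (H : Vec ℕ n) x → rowWeight c f H x ≤ rowWeight c f H (thresholdRow c H f)
rowWeight-max c f [] [] = ≤-refl
rowWeight-max c f (h ∷ H) (b ∷ x) = +-mono-≤ (weight-max c (f + h) b) (rowWeight-max c f H x)

rowWeight-max-unique : ∀ c f {n} (H : Vec ℕ n) x →
  rowWeight c f H x ≡ rowWeight c f H (thresholdRow c H f) → x ≡ thresholdRow c H f
rowWeight-max-unique c f [] [] eq = refl
rowWeight-max-unique c f (h ∷ H) (b ∷ x) eq with +-≤-≡-split (weight-max c (f + h) b) (rowWeight-max c f H x) eq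
... | eq₁ , eq₂ = cong₂ Vec._∷_ (weight-max-unique c (f + h) b eq₁) (rowWeight-max-unique c f H x eq₂)

matrixWeight-max : ∀ c {k n} (F : Vec ℕ k) (H : Vec ℕ n) X → matrixWeight c F H X ≤ matrixWeight c F H (thresholdMatrix c F H)
matrixWeight-max c [] H [] = ≤-refl
matrixWeight-max c (f ∷ F) H (x ∷ X) = +-mono-≤ (rowWeight-max c f H x) (matrixWeight-max c F H X)

matrixWeight-max-unique : ∀ c {k n} (F : Vec ℕ k) (H : Vec ℕ n) X →
  matrixWeight c F H X ≡ matrixWeight c F H (thresholdMatrix c F H) → X ≡ thresholdMatrix c F H
matrixWeight-max-unique c [] H [] eq = refl
matrixWeight-max-unique c (f ∷ F) H (x ∷ X) eq with +-≤-≡-split (rowWeight-max c f H x) (matrixWeight-max c F H X) eq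
... | eq₁ , eq₂ = cong₂ Vec._∷_ (rowWeight-max-unique c f H x eq₁) (matrixWeight-max-unique c F H X eq₂)

thresholdMatrix-lonesum : ∀ c {k n} (F : Vec ℕ k) (H : Vec ℕ n) → Lonesum (thresholdMatrix c F H)
thresholdMatrix-lonesum c {k} {n} F H B rowsB≡ colsB≡ = matrixWeight-max-unique c F H B (+-cancelʳ-≡ _ _ _ (begin
  matrixWeight c F H B + 2 * c * Vec.sum (rowSums B)
    ≡⟨ matrixWeight-identity c F H B ⟩
  2 * dot F (rowSums B) + 2 * dot H (colSums B) + Vec.sum (rowSums B) + 2 * c * n * k
    ≡⟨ cong₂ (λ r s → 2 * dot F r + 2 * dot H s + Vec.sum r + 2 * c * n * k) rowsB≡ colsB≡ ⟩
  2 * dot F (rowSums A) + 2 * dot H (colSums A) + Vec.sum (rowSums A) + 2 * c * n * k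
    ≡⟨ matrixWeight-identity c F H A ⟨
  matrixWeight c F H A + 2 * c * Vec.sum (rowSums A)
    ≡⟨ cong (λ r → matrixWeight c F H A + 2 * c * Vec.sum r) rowsB≡ ⟨
  matrixWeight c F H A + 2 * c * Vec.sum (rowSums B) ∎))
  where
  open ≡-Reasoning
  A : Matrix01 k n
  A = thresholdMatrix c F H

vec-ext : ∀ {A : Set} {n} {u v : Vec A n} → (∀ j → lookup u j ≡ lookup v j) → u ≡ v
vec-ext {u = u} {v} eq = trans (sym (tabulate∘lookup u)) (trans (tabulate-cong eq) (tabulate∘lookup v))

-- F i is the rank of row i among the c distinct rows, which are nested.  Every lonesum matrix has
-- such a representation (lonesum⇒canonical), and it is unique (thresholdMatrix-injective).
Canonical : ℕ → ∀ {k n} → Vec ℕ k → Vec ℕ n → Set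
Canonical c F H = Covers c 0 c F × Covers (suc c) 1 c H

level-<-separated : ∀ {c k n} {F : Vec ℕ k} {H : Vec ℕ n} → Canonical c F H → ∀ i i′ → lookup F i < lookup F i′ →
  ∃ λ j → c ≤ lookup F i′ + lookup H j × ¬ c ≤ lookup F i + lookup H j
level-<-separated {c} {F = F} {H} (covF , covH) i i′ Fi<Fi′ with onto covH (c ∸ lookup F i′) (m<n⇒0<n∸m (bounded covF i′))
                                                 (∸-monoʳ-< {c} (≤-<-trans z≤n Fi<Fi′) (<⇒≤ (bounded covF i′)))
... | j , Hj≡ = j , ≤-reflexive (sym sum≡c) ,
                λ c≤ → <-irrefl refl (≤-<-trans c≤ (subst (lookup F i + lookup H j <_) sum≡c (+-monoˡ-< (lookup H j) Fi<Fi′)))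
  where
  sum≡c : lookup F i′ + lookup H j ≡ c
  sum≡c = trans (cong (lookup F i′ +_) Hj≡) (m+[n∸m]≡n (<⇒≤ (bounded covF i′)))

level-order-transfer : ∀ {c c′ k n} {F F′ : Vec ℕ k} {H H′ : Vec ℕ n} → Canonical c F H →
  (∀ i j → (c ≤ᵇ lookup F i + lookup H j) ≡ (c′ ≤ᵇ lookup F′ i + lookup H′ j)) →
  ∀ i i′ → lookup F i < lookup F i′ → lookup F′ i < lookup F′ i′
level-order-transfer {c′ = c′} {F′ = F′} {H′ = H′} can same i i′ Fi<Fi′ with level-<-separated can i i′ Fi<Fi′
... | j , c≤ , c≰ = ≰⇒> λ F′i′≤F′i → c′≰ (≤-trans c′≤ (+-monoˡ-≤ (lookup H′ j) F′i′≤F′i))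
  where
  c′≤ : c′ ≤ lookup F′ i′ + lookup H′ j
  c′≤ = ≤ᵇ≡true⇒≤ (trans (sym (same i′ j)) (≤⇒≤ᵇ≡true c≤))
  c′≰ : ¬ c′ ≤ lookup F′ i + lookup H′ j
  c′≰ = ≤ᵇ≡false⇒≰ (trans (sym (same i j)) (≰⇒≤ᵇ≡false c≰))

onto-order-preserving⇒≤ : ∀ {k c} (F F′ : Vec ℕ k) → Covers c 0 c F →
  (∀ i i′ → lookup F i < lookup F i′ → lookup F′ i < lookup F′ i′) → ∀ i → lookup F i ≤ lookup F′ i
onto-order-preserving⇒≤ {c = c} F F′ covF mono i = go (lookup F i) i refl
  where
  go : ∀ v i → lookup F i ≡ v → lookup F i ≤ lookup F′ i
  go zero i Fi≡0 = subst (_≤ lookup F′ i) (sym Fi≡0) z≤n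
  go (suc v) i Fi≡1+v with onto covF v z≤n (<-trans (n<1+n v) (subst (_< c) Fi≡1+v (bounded covF i)))
  ... | i′ , Fi′≡v = subst (_≤ lookup F′ i) (sym Fi≡1+v)
    (≤-<-trans (subst (_≤ lookup F′ i′) Fi′≡v (go v i′ Fi′≡v))
               (mono i′ i (subst₂ _<_ (sym Fi′≡v) (sym Fi≡1+v) (n<1+n v))))

onto-bound-≤ : ∀ {k c c′} (F : Vec ℕ k) → Covers c 0 c F → (∀ i → lookup F i < c′) → c ≤ c′
onto-bound-≤ {c = zero} F covF F<c′ = z≤n
onto-bound-≤ {c = suc c} F covF F<c′ with onto covF c z≤n (n<1+n c)
... | i , Fi≡c = subst (_< _) Fi≡c (F<c′ i)

thresholds-≤ : ∀ {k n} c (F : Vec ℕ k) (H H′ : Vec ℕ n) → Covers c 0 c F → (∀ j → lookup H j ≤ c) →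
  (∀ i j → (c ≤ᵇ lookup F i + lookup H j) ≡ (c ≤ᵇ lookup F i + lookup H′ j)) → ∀ j → lookup H j ≤ lookup H′ j
thresholds-≤ c F H H′ covF H≤c same j with lookup H j in Hj≡ | H≤c j
... | zero | _ = z≤n
... | suc h | 1+h≤c with onto covF (c ∸ suc h) z≤n (∸-monoʳ-< {c} (s≤s z≤n) 1+h≤c)
...   | i , Fi≡ = +-cancelˡ-≤ (c ∸ suc h) (suc h) (lookup H′ j)
    (subst (λ z → z ≤ c ∸ suc h + lookup H′ j) (sym (m∸n+n≡m 1+h≤c))
      (subst (λ z → c ≤ z + lookup H′ j) Fi≡ (≤ᵇ≡true⇒≤ (trans (sym (same i j)) (≤⇒≤ᵇ≡true c≤FH)))))
  where
  c≤FH : c ≤ lookup F i + lookup H j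
  c≤FH = ≤-reflexive (sym (trans (cong₂ _+_ Fi≡ Hj≡) (m∸n+n≡m 1+h≤c)))

thresholdMatrix-injective : ∀ {k n c c′} {F F′ : Vec ℕ k} {H H′ : Vec ℕ n} → Canonical c F H → Canonical c′ F′ H′ →
  thresholdMatrix c F H ≡ thresholdMatrix c′ F′ H′ → c ≡ c′ × F ≡ F′ × H ≡ H′
thresholdMatrix-injective {c = c} {c′} {F} {F′} {H} {H′} can@(covF , covH) can′@(covF′ , covH′) A≡A′ =
  c≡c′ , F≡F′ , H≡H′
  where
  same : ∀ i j → (c ≤ᵇ lookup F i + lookup H j) ≡ (c′ ≤ᵇ lookup F′ i + lookup H′ j)
  same i j = trans (sym (lookup-thresholdMatrix c F H i j))
    (trans (cong (λ A → lookup (lookup A i) j) A≡A′) (lookup-thresholdMatrix c′ F′ H′ i j))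
  F≡F′ : F ≡ F′
  F≡F′ = vec-ext λ i → ≤-antisym
    (onto-order-preserving⇒≤ F F′ covF (level-order-transfer {c′ = c′} {F′ = F′} {H′ = H′} can same) i)
    (onto-order-preserving⇒≤ F′ F covF′ (level-order-transfer {c′ = c} {F′ = F} {H′ = H} can′ (λ i j → sym (same i j))) i)
  c≡c′ : c ≡ c′
  c≡c′ = ≤-antisym (onto-bound-≤ F covF (subst (λ G → ∀ i → lookup G i < c′) (sym F≡F′) (bounded covF′)))
                   (onto-bound-≤ F′ covF′ (subst (λ G → ∀ i → lookup G i < c) F≡F′ (bounded covF)))
  same′ : ∀ i j → (c ≤ᵇ lookup F i + lookup H j) ≡ (c ≤ᵇ lookup F i + lookup H′ j)
  same′ i j = trans (same i j) (cong₂ (λ d G → d ≤ᵇ lookup G i + lookup H′ j) (sym c≡c′) (sym F≡F′))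
  H′≤c : ∀ j → lookup H′ j ≤ c
  H′≤c j = ≤-pred (subst (lookup H′ j <_) (cong suc (sym c≡c′)) (bounded covH′ j))
  H≡H′ : H ≡ H′
  H≡H′ = vec-ext λ j → ≤-antisym (thresholds-≤ c F H H′ covF (λ j → ≤-pred (bounded covH j)) same′ j)
                                 (thresholds-≤ c F H′ H covF H′≤c (λ i j → sym (same′ i j)) j)

-- Lonesum matrices are threshold matrices

lonesum-tail : ∀ {k n} (x : Vec Bool n) (A : Matrix01 k n) → Lonesum (x ∷ A) → Lonesum A
lonesum-tail x A lonesum B rowsB≡ colsB≡ = proj₂ (∷-injective (lonesum (x ∷ B) (cong (vsum x ∷_) rowsB≡)
  (trans (colSums-∷ x B) (trans (cong (zipWith _+_ (bits x)) colsB≡) (sym (colSums-∷ x A))))))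

_⊆ᵇ_ : ∀ {n} → Vec Bool n → Vec Bool n → Set
x ⊆ᵇ y = ∀ j → lookup x j ≡ true → lookup y j ≡ true

⊆ᵇ-or-witness : ∀ {n} (x y : Vec Bool n) → x ⊆ᵇ y ⊎ ∃ λ j → lookup x j ≡ true × lookup y j ≡ false
⊆ᵇ-or-witness x y with any? (λ j → (lookup x j ≟ᵇ true) ×-dec (lookup y j ≟ᵇ false))
... | yes witness = inj₂ witness
... | no no-witness = inj₁ x⊆y
  where
  x⊆y : x ⊆ᵇ y
  x⊆y j xj≡true with lookup y j in yj≡
  ... | true = refl
  ... | false = ⊥-elim (no-witness (j , xj≡true , yj≡))

vsum-[]≔ : ∀ {n} (v : Vec Bool n) j b → vsum (v [ j ]≔ b) + bit (lookup v j) ≡ vsum v + bit b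
vsum-[]≔ (a ∷ v) zero b = +-CS.xy∙z≈zy∙x (bit b) (vsum v) (bit a)
vsum-[]≔ (a ∷ v) (suc j) b = begin
  bit a + vsum (v [ j ]≔ b) + bit (lookup v j) ≡⟨ +-assoc (bit a) _ _ ⟩
  bit a + (vsum (v [ j ]≔ b) + bit (lookup v j)) ≡⟨ cong (bit a +_) (vsum-[]≔ v j b) ⟩
  bit a + (vsum v + bit b) ≡⟨ +-assoc (bit a) _ _ ⟨
  bit a + vsum v + bit b ∎
  where open ≡-Reasoning

lookup-colSums-[]≔ : ∀ {k n} (A : Matrix01 k n) i z j →
  lookup (colSums (A [ i ]≔ z)) j + bit (lookup (lookup A i) j) ≡ lookup (colSums A) j + bit (lookup z j)
lookup-colSums-[]≔ (a ∷ A) zero z j rewrite lookup-colSums-∷ z A j | lookup-colSums-∷ a A j =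
  +-CS.xy∙z≈zy∙x (bit (lookup z j)) (lookup (colSums A) j) (bit (lookup a j))
lookup-colSums-[]≔ (a ∷ A) (suc i) z j rewrite lookup-colSums-∷ a (A [ i ]≔ z) j | lookup-colSums-∷ a A j = begin
  bit (lookup a j) + lookup (colSums (A [ i ]≔ z)) j + bit (lookup (lookup A i) j)
    ≡⟨ +-assoc (bit (lookup a j)) _ _ ⟩
  bit (lookup a j) + (lookup (colSums (A [ i ]≔ z)) j + bit (lookup (lookup A i) j))
    ≡⟨ cong (bit (lookup a j) +_) (lookup-colSums-[]≔ A i z j) ⟩
  bit (lookup a j) + (lookup (colSums A) j + bit (lookup z j))
    ≡⟨ +-assoc (bit (lookup a j)) _ _ ⟨
  bit (lookup a j) + lookup (colSums A) j + bit (lookup z j) ∎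
  where open ≡-Reasoning

rowSums-exchange : ∀ {k n} (x x′ : Vec Bool n) (A : Matrix01 k n) i z → vsum x′ ≡ vsum x → vsum z ≡ vsum (lookup A i) →
  rowSums (x′ ∷ A [ i ]≔ z) ≡ rowSums (x ∷ A)
rowSums-exchange x x′ A i z x′≡x z≡Ai = cong₂ Vec._∷_ x′≡x (begin
  Vec.map vsum (A [ i ]≔ z) ≡⟨ map-[]≔ vsum A i ⟩
  Vec.map vsum A [ i ]≔ vsum z ≡⟨ cong (Vec.map vsum A [ i ]≔_) (trans z≡Ai (sym (lookup-map i vsum A))) ⟩
  Vec.map vsum A [ i ]≔ lookup (Vec.map vsum A) i ≡⟨ []≔-lookup (Vec.map vsum A) i ⟩
  Vec.map vsum A ∎)
  where open ≡-Reasoning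

exchange-arith : ∀ a′ z a y s t → s + y ≡ t + z → a′ + z ≡ a + y → a′ + s ≡ a + t
exchange-arith a′ z a y s t s+y≡t+z a′+z≡a+y = +-cancelʳ-≡ y _ _ (begin
  a′ + s + y   ≡⟨ +-assoc a′ s y ⟩
  a′ + (s + y) ≡⟨ cong (a′ +_) s+y≡t+z ⟩
  a′ + (t + z) ≡⟨ +-CS.x∙yz≈y∙xz a′ t z ⟩
  t + (a′ + z) ≡⟨ cong (t +_) a′+z≡a+y ⟩
  t + (a + y)  ≡⟨ +-CS.x∙yz≈yx∙z t a y ⟩
  a + t + y    ∎)
  where open ≡-Reasoning

colSums-exchange : ∀ {k n} (x x′ : Vec Bool n) (A : Matrix01 k n) i z →
  (∀ j → bit (lookup x′ j) + bit (lookup z j) ≡ bit (lookup x j) + bit (lookup (lookup A i) j)) →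
  colSums (x′ ∷ A [ i ]≔ z) ≡ colSums (x ∷ A)
colSums-exchange x x′ A i z same = vec-ext λ j → begin
  lookup (colSums (x′ ∷ A [ i ]≔ z)) j ≡⟨ lookup-colSums-∷ x′ (A [ i ]≔ z) j ⟩
  bit (lookup x′ j) + lookup (colSums (A [ i ]≔ z)) j
    ≡⟨ exchange-arith _ (bit (lookup z j)) _ (bit (lookup (lookup A i) j)) _ _ (lookup-colSums-[]≔ A i z j) (same j) ⟩
  bit (lookup x j) + lookup (colSums A) j ≡⟨ lookup-colSums-∷ x A j ⟨
  lookup (colSums (x ∷ A)) j ∎
  where open ≡-Reasoning

swapEntries : ∀ {A : Set} {n} → Vec A n → Fin n → Fin n → Vec A n
swapEntries v j₁ j₂ = (v [ j₁ ]≔ lookup v j₂) [ j₂ ]≔ lookup v j₁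

lookup-swapEntries-j₂ : ∀ {A : Set} {n} (v : Vec A n) j₁ j₂ → lookup (swapEntries v j₁ j₂) j₂ ≡ lookup v j₁
lookup-swapEntries-j₂ v j₁ j₂ = lookup∘update j₂ (v [ j₁ ]≔ lookup v j₂) (lookup v j₁)

lookup-swapEntries-j₁ : ∀ {A : Set} {n} (v : Vec A n) {j₁ j₂} → j₁ ≢ j₂ → lookup (swapEntries v j₁ j₂) j₁ ≡ lookup v j₂
lookup-swapEntries-j₁ v {j₁} {j₂} j₁≢j₂ =
  trans (lookup∘update′ j₁≢j₂ (v [ j₁ ]≔ lookup v j₂) (lookup v j₁)) (lookup∘update j₁ v (lookup v j₂))

lookup-swapEntries-other : ∀ {A : Set} {n} (v : Vec A n) {j₁ j₂ j} → j ≢ j₁ → j ≢ j₂ →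
  lookup (swapEntries v j₁ j₂) j ≡ lookup v j
lookup-swapEntries-other v {j₁} {j₂} j≢j₁ j≢j₂ =
  trans (lookup∘update′ j≢j₂ (v [ j₁ ]≔ lookup v j₂) (lookup v j₁)) (lookup∘update′ j≢j₁ v (lookup v j₂))

vsum-swapEntries : ∀ {n} (v : Vec Bool n) j₁ j₂ → vsum (swapEntries v j₁ j₂) ≡ vsum v
vsum-swapEntries {n} v j₁ j₂ = +-cancelʳ-≡ (bit (lookup v j₂)) _ _ (begin
  vsum (w [ j₂ ]≔ lookup v j₁) + bit (lookup v j₂) ≡⟨ cong (λ b → vsum (w [ j₂ ]≔ lookup v j₁) + bit b) w-j₂ ⟨
  vsum (w [ j₂ ]≔ lookup v j₁) + bit (lookup w j₂) ≡⟨ vsum-[]≔ w j₂ (lookup v j₁) ⟩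
  vsum w + bit (lookup v j₁) ≡⟨ vsum-[]≔ v j₁ (lookup v j₂) ⟩
  vsum v + bit (lookup v j₂) ∎)
  where
  open ≡-Reasoning
  w : Vec Bool n
  w = v [ j₁ ]≔ lookup v j₂
  w-j₂ : lookup w j₂ ≡ lookup v j₂
  w-j₂ with j₂ ≟ᶠ j₁
  ... | yes refl = lookup∘update j₁ v (lookup v j₂)
  ... | no j₂≢j₁ = lookup∘update′ j₂≢j₁ v (lookup v j₂)

bit-sum-swapEntries : ∀ {n} (x y : Vec Bool n) j₁ j₂ →
  bit (lookup x j₁) + bit (lookup y j₁) ≡ bit (lookup x j₂) + bit (lookup y j₂) → ∀ j →
  bit (lookup (swapEntries x j₁ j₂) j) + bit (lookup (swapEntries y j₁ j₂) j) ≡ bit (lookup x j) + bit (lookup y j)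
bit-sum-swapEntries x y j₁ j₂ same j with j ≟ᶠ j₂ | j ≟ᶠ j₁
... | yes refl | _ rewrite lookup-swapEntries-j₂ x j₁ j | lookup-swapEntries-j₂ y j₁ j = same
... | no j≢j₂ | yes refl rewrite lookup-swapEntries-j₁ x j≢j₂ | lookup-swapEntries-j₁ y j≢j₂ = sym same
... | no j≢j₂ | no j≢j₁ rewrite lookup-swapEntries-other x j≢j₁ j≢j₂ | lookup-swapEntries-other y j≢j₁ j≢j₂ = refl

-- If neither row contains the other, some columns j₁ , j₂ carry the pattern (1 0 / 0 1) in the
-- rows x and A i; swapping these two entries in both rows keeps all row and column sums.
lonesum-rows-comparable : ∀ {k n} (x : Vec Bool n) (A : Matrix01 k n) → Lonesum (x ∷ A) →
  ∀ i → x ⊆ᵇ lookup A i ⊎ lookup A i ⊆ᵇ x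
lonesum-rows-comparable {n = n} x A lonesum i with ⊆ᵇ-or-witness x (lookup A i) | ⊆ᵇ-or-witness (lookup A i) x
... | inj₁ x⊆y | _ = inj₁ x⊆y
... | inj₂ _ | inj₁ y⊆x = inj₂ y⊆x
... | inj₂ (j₁ , xj₁≡1 , yj₁≡0) | inj₂ (j₂ , yj₂≡1 , xj₂≡0) = ⊥-elim (false≢true (begin
  false ≡⟨ xj₂≡0 ⟨
  lookup x j₂ ≡⟨ lookup-swapEntries-j₁ x j₁≢j₂ ⟨
  lookup (swapEntries x j₁ j₂) j₁ ≡⟨ cong (λ v → lookup v j₁) (proj₁ (∷-injective (lonesum _ rows≡ cols≡))) ⟩
  lookup x j₁ ≡⟨ xj₁≡1 ⟩
  true ∎))
  where
  open ≡-Reasoning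
  y : Vec Bool n
  y = lookup A i
  false≢true : false ≢ true
  false≢true ()
  j₁≢j₂ : j₁ ≢ j₂
  j₁≢j₂ refl = false≢true (trans (sym xj₂≡0) xj₁≡1)
  rows≡ : rowSums (swapEntries x j₁ j₂ ∷ A [ i ]≔ swapEntries y j₁ j₂) ≡ rowSums (x ∷ A)
  rows≡ = rowSums-exchange x (swapEntries x j₁ j₂) A i (swapEntries y j₁ j₂)
            (vsum-swapEntries x j₁ j₂) (vsum-swapEntries y j₁ j₂)
  cols≡ : colSums (swapEntries x j₁ j₂ ∷ A [ i ]≔ swapEntries y j₁ j₂) ≡ colSums (x ∷ A)
  cols≡ = colSums-exchange x (swapEntries x j₁ j₂) A i (swapEntries y j₁ j₂) (bit-sum-swapEntries x y j₁ j₂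
    (trans (cong₂ (λ a b → bit a + bit b) xj₁≡1 yj₁≡0) (sym (cong₂ (λ a b → bit a + bit b) xj₂≡0 yj₂≡1))))

⊆ᵇ-≢⇒witness : ∀ {n} {x y : Vec Bool n} → x ⊆ᵇ y → x ≢ y → ∃ λ j → lookup x j ≡ false × lookup y j ≡ true
⊆ᵇ-≢⇒witness {x = x} {y} x⊆y x≢y with any? (λ j → ¬? (lookup x j ≟ᵇ lookup y j))
... | no all-equal = ⊥-elim (x≢y (vec-ext λ j → decidable-stable (lookup x j ≟ᵇ lookup y j) (λ ne → all-equal (j , ne))))
... | yes (j , xj≢yj) with lookup x j in xj≡ | lookup y j in yj≡
...   | false | true = j , xj≡ , yj≡
...   | false | false = ⊥-elim (xj≢yj refl)
...   | true | true = ⊥-elim (xj≢yj refl)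
...   | true | false = ⊥-elim (xj≢yj (trans (sym (x⊆y j xj≡)) yj≡))

≤ᵇ-cong : ∀ m n m′ n′ → (m ≤ n → m′ ≤ n′) → (m′ ≤ n′ → m ≤ n) → (m ≤ᵇ n) ≡ (m′ ≤ᵇ n′)
≤ᵇ-cong m n m′ n′ to from with m ≤? n
... | yes m≤n rewrite ≤⇒≤ᵇ≡true m≤n | ≤⇒≤ᵇ≡true (to m≤n) = refl
... | no m≰n rewrite ≰⇒≤ᵇ≡false m≰n | ≰⇒≤ᵇ≡false (λ m′≤n′ → m≰n (from m′≤n′)) = refl

punchIn-cases : ∀ p f → (f < p × punchIn p f ≡ f) ⊎ (p ≤ f × punchIn p f ≡ suc f)
punchIn-cases p f with <-≤-connex f p
... | inj₁ f<p = inj₁ (f<p , punchIn-< f<p)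
... | inj₂ p≤f = inj₂ (p≤f , punchIn-≥ p≤f)

+-bit : ∀ f h b → f + (h + bit b) ≡ bit b + (f + h)
+-bit f h b = trans (sym (+-assoc f h (bit b))) (+-comm (f + h) (bit b))

bit≤1 : ∀ b → bit b ≤ 1
bit≤1 true = ≤-refl
bit≤1 false = z≤n

insertion-entry : ∀ c p f h b → (b ≡ true → c ≤ p + h) → (b ≡ false → p + h ≤ c) →
  (c ≤ᵇ f + h) ≡ (suc c ≤ᵇ punchIn p f + (h + bit b))
insertion-entry c p f h true in-row _ with punchIn-cases p f
... | inj₁ (f<p , ≡f) rewrite ≡f | +-bit f h true = ≤ᵇ-cong c (f + h) (suc c) (suc (f + h)) s≤s ≤-pred
... | inj₂ (p≤f , ≡1+f) rewrite ≡1+f | +-bit (suc f) h true =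
  ≤ᵇ-cong c (f + h) (suc c) (suc (suc f + h)) (λ _ → s≤s (m≤n⇒m≤1+n c≤)) (λ _ → c≤)
  where
  c≤ : c ≤ f + h
  c≤ = ≤-trans (in-row refl) (+-monoˡ-≤ h p≤f)
insertion-entry c p f h false _ below with punchIn-cases p f
... | inj₁ (f<p , ≡f) rewrite ≡f | +-bit f h false =
  ≤ᵇ-cong c (f + h) (suc c) (f + h) (λ c≤ → ⊥-elim (c≰ c≤)) (λ 1+c≤ → ⊥-elim (c≰ (≤-trans (n≤1+n c) 1+c≤)))
  where
  c≰ : ¬ c ≤ f + h
  c≰ c≤ = <-irrefl refl (≤-<-trans c≤ (<-≤-trans (+-monoˡ-< h f<p) (below refl)))
... | inj₂ (p≤f , ≡1+f) rewrite ≡1+f | +-bit (suc f) h false = ≤ᵇ-cong c (f + h) (suc c) (suc f + h) s≤s ≤-pred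

-- Inserting a new row x strictly between the rows of levels p - 1 and p of a canonical
-- representation: the old levels f ≥ p move up by one, and each threshold H j grows by x j.
module Insertion {n} (c : ℕ) (H : Vec ℕ n) (x : Vec Bool n) (p : ℕ)
  (row[p-1]⊆x : ∀ j → suc c ≤ p + lookup H j → lookup x j ≡ true)
  (x⊆row[p] : ∀ j → lookup x j ≡ true → c ≤ p + lookup H j) where

  H′ : Vec ℕ n
  H′ = zipWith (λ h b → h + bit b) H x

  lookup-H′ : ∀ j → lookup H′ j ≡ lookup H j + bit (lookup x j)
  lookup-H′ j = lookup-zipWith _ j H x

  outside⇒below : ∀ j → lookup x j ≡ false → p + lookup H j ≤ c
  outside⇒below j xj≡0 = ≤-pred (≰⇒> λ above → false≢true (trans (sym xj≡0) (row[p-1]⊆x j above)))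
    where
    false≢true : false ≢ true
    false≢true ()

  threshold-entry : ∀ f j → (c ≤ᵇ f + lookup H j) ≡ (suc c ≤ᵇ punchIn p f + (lookup H j + bit (lookup x j)))
  threshold-entry f j = insertion-entry c p f (lookup H j) (lookup x j) (x⊆row[p] j) (outside⇒below j)

  new-row : thresholdRow (suc c) H′ p ≡ x
  new-row = vec-ext λ j →
    trans (lookup-thresholdRow (suc c) H′ p j) (trans (cong (λ h → suc c ≤ᵇ p + h) (lookup-H′ j)) (entry j))
    where
    entry : ∀ j → (suc c ≤ᵇ p + (lookup H j + bit (lookup x j))) ≡ lookup x j
    entry j with lookup x j in xj≡
    ... | true rewrite +-bit p (lookup H j) true = ≤⇒≤ᵇ≡true (s≤s (x⊆row[p] j xj≡))
    ... | false rewrite +-bit p (lookup H j) false =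
      ≰⇒≤ᵇ≡false (λ 1+c≤ → <-irrefl refl (≤-<-trans (outside⇒below j xj≡) 1+c≤))

  insertion-matrix : ∀ {k} (F : Vec ℕ k) → x ∷ thresholdMatrix c F H ≡ thresholdMatrix (suc c) (freshHead p F) H′
  insertion-matrix F = cong₂ Vec._∷_ (sym new-row) (trans (map-cong old-row F) (map-∘ (thresholdRow (suc c) H′) (punchIn p) F))
    where
    old-row : ∀ f → thresholdRow c H f ≡ thresholdRow (suc c) H′ (punchIn p f)
    old-row f = vec-ext λ j → trans (lookup-thresholdRow c H f j)
      (trans (threshold-entry f j) (sym (trans (lookup-thresholdRow (suc c) H′ (punchIn p f) j)
                                                (cong (λ h → suc c ≤ᵇ punchIn p f + h) (lookup-H′ j)))))

  module _ (covH : Covers (suc c) 1 c H) where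

    private
      hit : ∀ {t} j → lookup H j + bit (lookup x j) ≡ t → ∃ λ j → lookup H′ j ≡ t
      hit j eq = j , trans (lookup-H′ j) eq

    hit-below : ∀ t → 1 ≤ t → p + t < c → ∃ λ j → lookup H′ j ≡ t
    hit-below t 1≤t p+t<c with onto covH t 1≤t (≤-<-trans (m≤n+m t p) p+t<c)
    ... | j , Hj≡t with lookup x j in xj≡
    ...   | true = ⊥-elim (<⇒≱ p+t<c (subst (λ h → c ≤ p + h) Hj≡t (x⊆row[p] j xj≡)))
    ...   | false = hit j (trans (cong (λ b → lookup H j + bit b) xj≡) (trans (+-identityʳ _) Hj≡t))

    hit-at : ∀ t → p + t ≡ c → (∃ λ j → lookup x j ≡ false × c ≤ p + lookup H j) → ∃ λ j → lookup H′ j ≡ t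
    hit-at t p+t≡c (j , xj≡0 , c≤) = hit j (begin
      lookup H j + bit (lookup x j) ≡⟨ cong (λ b → lookup H j + bit b) xj≡0 ⟩
      lookup H j + 0 ≡⟨ +-identityʳ _ ⟩
      lookup H j ≡⟨ +-cancelˡ-≡ p _ _ (trans (≤-antisym (outside⇒below j xj≡0) c≤) (sym p+t≡c)) ⟩
      t ∎)
      where open ≡-Reasoning

    hit-just-above : ∀ p′ t → p ≡ suc p′ → p + t ≡ suc c → (∃ λ j → lookup x j ≡ true × ¬ c ≤ p′ + lookup H j) →
      ∃ λ j → lookup H′ j ≡ t
    hit-just-above p′ t refl p+t≡1+c (j , xj≡1 , c≰) = hit j (begin
      lookup H j + bit (lookup x j) ≡⟨ cong (λ b → lookup H j + bit b) xj≡1 ⟩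
      lookup H j + 1 ≡⟨ +-comm (lookup H j) 1 ⟩
      suc (lookup H j) ≡⟨ +-cancelˡ-≡ p′ _ _ (trans (+-suc p′ (lookup H j)) (trans (sym c≡) (suc-injective (sym p+t≡1+c)))) ⟩
      t ∎)
      where
      open ≡-Reasoning
      c≡ : c ≡ suc (p′ + lookup H j)
      c≡ = ≤-antisym (x⊆row[p] j xj≡1) (≰⇒> c≰)

    hit-far-above : ∀ t → t < suc c → p ≤ c → suc c < p + t → ∃ λ j → lookup H′ j ≡ t
    hit-far-above zero _ p≤c 1+c<p+0 = ⊥-elim (<⇒≱ 1+c<p+0 (≤-trans (≤-reflexive (+-identityʳ p)) (m≤n⇒m≤1+n p≤c)))
    hit-far-above (suc zero) _ p≤c 1+c<p+1 =
      ⊥-elim (<-irrefl refl (≤-trans 1+c<p+1 (≤-trans (≤-reflexive (+-comm p 1)) (s≤s p≤c))))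
    hit-far-above (suc t′@(suc _)) 1+t′<1+c p≤c 1+c<p+1+t′ with onto covH t′ (s≤s z≤n) (≤-pred 1+t′<1+c)
    ... | j , Hj≡t′ = hit j (begin
      lookup H j + bit (lookup x j) ≡⟨ cong (λ b → lookup H j + bit b) xj≡1 ⟩
      lookup H j + 1 ≡⟨ +-comm (lookup H j) 1 ⟩
      suc (lookup H j) ≡⟨ cong suc Hj≡t′ ⟩
      suc t′ ∎)
      where
      open ≡-Reasoning
      xj≡1 : lookup x j ≡ true
      xj≡1 = row[p-1]⊆x j (subst (λ h → suc c ≤ p + h) (sym Hj≡t′) (≤-pred (subst (suc c <_) (+-suc p t′) 1+c<p+1+t′)))

    thresholds-covers : p ≤ c →
      (∀ p′ → p ≡ suc p′ → ∃ λ j → lookup x j ≡ true × ¬ c ≤ p′ + lookup H j) →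
      (p < c → ∃ λ j → lookup x j ≡ false × c ≤ p + lookup H j) →
      Covers (suc (suc c)) 1 (suc c) H′
    thresholds-covers p≤c x≢row[p-1] x≢row[p] = mkCovers bounded′ onto′
      where
      bounded′ : ∀ j → lookup H′ j < suc (suc c)
      bounded′ j = s≤s (subst₂ _≤_ (sym (lookup-H′ j)) (+-comm c 1) (+-mono-≤ (≤-pred (bounded covH j)) (bit≤1 (lookup x j))))
      onto′ : ∀ t → 1 ≤ t → t < suc c → ∃ λ j → lookup H′ j ≡ t
      onto′ t 1≤t t<1+c with <-cmp (p + t) c
      ... | tri< p+t<c _ _ = hit-below t 1≤t p+t<c
      ... | tri≈ _ p+t≡c _ = hit-at t p+t≡c (x≢row[p] (subst (p <_) p+t≡c (m<m+n p 1≤t)))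
      ... | tri> _ _ c<p+t with <-cmp (p + t) (suc c)
      ...   | tri< p+t<1+c _ _ = ⊥-elim (<-irrefl refl (<-≤-trans c<p+t (≤-pred p+t<1+c)))
      ...   | tri≈ _ p+t≡1+c _ = hit-just-above (pred p) t p≡1+p′ p+t≡1+c (x≢row[p-1] (pred p) p≡1+p′)
        where
        p≡1+p′ : p ≡ suc (pred p)
        p≢0 : p ≢ 0
        p≢0 p≡0 = <-irrefl (trans (sym (cong (_+ t) p≡0)) p+t≡1+c) t<1+c
        p≡1+p′ = sym (suc-pred p {{≢-nonZero p≢0}})
      ...   | tri> _ _ 1+c<p+t = hit-far-above t t<1+c p≤c 1+c<p+t

module _ (c : ℕ) {n} (H : Vec ℕ n) (t : ℕ) (j : Fin n) where

  thresholdRow-true⇒ : lookup (thresholdRow c H t) j ≡ true → c ≤ t + lookup H j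
  thresholdRow-true⇒ eq = ≤ᵇ≡true⇒≤ (trans (sym (lookup-thresholdRow c H t j)) eq)

  thresholdRow-true⇐ : c ≤ t + lookup H j → lookup (thresholdRow c H t) j ≡ true
  thresholdRow-true⇐ c≤ = trans (lookup-thresholdRow c H t j) (≤⇒≤ᵇ≡true c≤)

  thresholdRow-false⇒ : lookup (thresholdRow c H t) j ≡ false → ¬ c ≤ t + lookup H j
  thresholdRow-false⇒ eq = ≤ᵇ≡false⇒≰ (trans (sym (lookup-thresholdRow c H t j)) eq)

Extension : ℕ → ∀ {k n} → Vec ℕ k → Vec ℕ n → Vec Bool n → Set
Extension c {k} {n} F H x = ∃ λ c′ → ∃ λ (F′ : Vec ℕ (suc k)) → ∃ λ (H′ : Vec ℕ n) →
  c′ ≤ suc c × Canonical c′ F′ H′ × x ∷ thresholdMatrix c F H ≡ thresholdMatrix c′ F′ H′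

module CanonicalExtension {k n c} {F : Vec ℕ k} {H : Vec ℕ n} (can : Canonical c F H) (x : Vec Bool n)
  (comparable : ∀ t → t < c → thresholdRow c H t ⊆ᵇ x ⊎ x ⊆ᵇ thresholdRow c H t) where

  covF : Covers c 0 c F
  covF = proj₁ can

  covH : Covers (suc c) 1 c H
  covH = proj₂ can

  -- x contains the row of level p - 1 and is contained in the row of level p, where the row of
  -- level -1 is empty and the row of level c is full.
  RowBelow RowAbove : ℕ → Set
  RowBelow p = ∀ j → suc c ≤ p + lookup H j → lookup x j ≡ true
  RowAbove p = ∀ j → lookup x j ≡ true → c ≤ p + lookup H j

  locate : ∀ t → t ≤ c → RowAbove t → ∃ λ p → p ≤ c × RowBelow p × RowAbove p
  locate zero _ above = 0 , z≤n , (λ j 1+c≤Hj → ⊥-elim (<-irrefl refl (≤-trans 1+c≤Hj (≤-pred (bounded covH j))))) , above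
  locate (suc t) 1+t≤c above with comparable t 1+t≤c
  ... | inj₁ row⊆x = suc t , 1+t≤c , (λ j 1+c≤ → row⊆x j (thresholdRow-true⇐ c H t j (≤-pred 1+c≤))) , above
  ... | inj₂ x⊆row = locate t (≤-trans (n≤1+n t) 1+t≤c) (λ j xj≡1 → thresholdRow-true⇒ c H t j (x⊆row j xj≡1))

  existing-level : ∀ t → t < c → x ≡ thresholdRow c H t → Extension c F H x
  existing-level t t<c x≡row = c , t ∷ F , H , n≤1+n c , (∷-covers t<c covF , covH) , cong (_∷ thresholdMatrix c F H) x≡row

  new-level : ∀ p → p ≤ c → RowBelow p → RowAbove p →
    (∀ p′ → p ≡ suc p′ → ∃ λ j → lookup x j ≡ true × ¬ c ≤ p′ + lookup H j) →
    (p < c → ∃ λ j → lookup x j ≡ false × c ≤ p + lookup H j) → Extension c F H x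
  new-level p p≤c below above x≢row[p-1] x≢row[p] =
    suc c , freshHead p F , H′ , ≤-refl ,
    (punchIn-covers z≤n p≤c ≤-refl covF , thresholds-covers covH p≤c x≢row[p-1] x≢row[p]) , insertion-matrix F
    where open Insertion c H x p below above

  upper-neighbour : ∀ p → p ≤ c → RowBelow p → RowAbove p →
    (∀ p′ → p ≡ suc p′ → ∃ λ j → lookup x j ≡ true × ¬ c ≤ p′ + lookup H j) → Extension c F H x
  upper-neighbour p p≤c below above x≢row[p-1] with p <? c
  ... | no p≮c = new-level p p≤c below above x≢row[p-1] (λ p<c → ⊥-elim (p≮c p<c))
  ... | yes p<c with ≡-dec _≟ᵇ_ x (thresholdRow c H p)
  ...   | yes x≡row = existing-level p p<c x≡row
  ...   | no x≢row with ⊆ᵇ-≢⇒witness (λ j xj≡1 → thresholdRow-true⇐ c H p j (above j xj≡1)) x≢row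
  ...     | j , xj≡0 , rowj≡1 = new-level p p≤c below above x≢row[p-1] (λ _ → j , xj≡0 , thresholdRow-true⇒ c H p j rowj≡1)

  lower-neighbour : ∀ p → p ≤ c → RowBelow p → RowAbove p → Extension c F H x
  lower-neighbour zero p≤c below above = upper-neighbour zero p≤c below above (λ _ ())
  lower-neighbour (suc p′) p≤c below above with ≡-dec _≟ᵇ_ x (thresholdRow c H p′)
  ... | yes x≡row = existing-level p′ p≤c x≡row
  ... | no x≢row
    with ⊆ᵇ-≢⇒witness (λ j rowj≡1 → below j (s≤s (thresholdRow-true⇒ c H p′ j rowj≡1))) (λ row≡x → x≢row (sym row≡x))
  ...   | j , rowj≡0 , xj≡1 = upper-neighbour (suc p′) p≤c below above
    (λ { p″ refl → j , xj≡1 , thresholdRow-false⇒ c H p′ j rowj≡0 })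

  extension : Extension c F H x
  extension with locate c ≤-refl (λ j _ → m≤m+n c (lookup H j))
  ... | p , p≤c , below , above = lower-neighbour p p≤c below above

lonesum⇒canonical : ∀ k {n} (A : Matrix01 k n) → Lonesum A →
  ∃ λ c → ∃ λ (F : Vec ℕ k) → ∃ λ (H : Vec ℕ n) → c ≤ k × Canonical c F H × A ≡ thresholdMatrix c F H
lonesum⇒canonical zero {n} [] _ =
  0 , [] , replicate n 0 , z≤n ,
  (mkCovers (λ ()) (λ _ _ ()) , mkCovers (λ j → s≤s (≤-reflexive (lookup-replicate j 0))) (λ _ _ ())) , refl
lonesum⇒canonical (suc k) (x ∷ A) lonesum with lonesum⇒canonical k A (lonesum-tail x A lonesum)
... | c , F , H , c≤k , can@(covF , _) , refl with CanonicalExtension.extension can x comparable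
  where
  comparable : ∀ t → t < c → thresholdRow c H t ⊆ᵇ x ⊎ x ⊆ᵇ thresholdRow c H t
  comparable t t<c with onto covF t z≤n t<c
  ... | i , Fi≡t with lookup-map i (thresholdRow c H) F | lonesum-rows-comparable x (thresholdMatrix c F H) lonesum i
  ...   | rowᵢ≡ | inj₁ x⊆rowᵢ = inj₂ (subst (λ r → x ⊆ᵇ r) (trans rowᵢ≡ (cong (thresholdRow c H) Fi≡t)) x⊆rowᵢ)
  ...   | rowᵢ≡ | inj₂ rowᵢ⊆x = inj₁ (subst (λ r → r ⊆ᵇ x) (trans rowᵢ≡ (cong (thresholdRow c H) Fi≡t)) rowᵢ⊆x)
... | c′ , F′ , H′ , c′≤1+c , can′ , eq = c′ , F′ , H′ , ≤-trans c′≤1+c (s≤s c≤k) , can′ , eq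

-- Counting lonesum matrices

unique-⇔⇒length-≡ : ∀ {A : Set} {xs ys : List A} → Unique xs → Unique ys → (∀ {x} → x ∈ xs ⇔ x ∈ ys) →
  length xs ≡ length ys
unique-⇔⇒length-≡ xs! ys! xs⇔ys = ↭-length (∼bag⇒↭ (unique∧set⇒bag xs! ys! xs⇔ys))

map-unique : ∀ {A B : Set} (f : A → B) {xs : List A} → (∀ {x y} → x ∈ xs → y ∈ xs → f x ≡ f y → x ≡ y) →
  Unique xs → Unique (List.map f xs)
map-unique f {[]} injective [] = []
map-unique f {x ∷ xs} injective (x∉xs ∷ xs!) =
  All.tabulate fx∉ ∷ map-unique f (λ y∈ z∈ → injective (there y∈) (there z∈)) xs!
  where
  fx∉ : ∀ {z} → z ∈ List.map f xs → f x ≢ z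
  fx∉ z∈ fx≡z with ∈-map⁻ f z∈
  ... | y , y∈ , refl = All.lookup x∉xs y∈ (injective (here refl) (there y∈) fx≡z)

vecs-unique : ∀ {A : Set} {xs : List A} → Unique xs → ∀ n → Unique (vecs xs n)
vecs-unique xs! zero = All.[] ∷ []
vecs-unique xs! (suc n) = Unique.cartesianProductWith⁺ Vec._∷_ ∷-injective xs! (vecs-unique xs! n)

allMatrices-unique : ∀ k n → Unique (allMatrices k n)
allMatrices-unique k n = vecs-unique (vecs-unique bools! n) k
  where
  bools! : Unique bools
  bools! = ((λ ()) All.∷ All.[]) ∷ (All.[] ∷ [])

lonesumMatrices : ∀ k n → List (Matrix01 k n)
lonesumMatrices k n = filter lonesum? (allMatrices k n)

lonesumMatrices-unique : ∀ k n → Unique (lonesumMatrices k n)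
lonesumMatrices-unique k n = Unique.filter⁺ lonesum? (allMatrices-unique k n)

∈-lonesumMatrices⁺ : ∀ {k n} {A : Matrix01 k n} → Lonesum A → A ∈ lonesumMatrices k n
∈-lonesumMatrices⁺ {k} {n} {A} = ∈-filter⁺ lonesum? (allMatrices-complete k n A)

∈-lonesumMatrices⁻ : ∀ {k n} {A : Matrix01 k n} → A ∈ lonesumMatrices k n → Lonesum A
∈-lonesumMatrices⁻ {k} {n} A∈ = proj₂ (∈-filter⁻ lonesum? {xs = allMatrices k n} A∈)

-- (r , F , H) stands for the canonical representation with c = suc r.
Triple : ℕ → ℕ → Set
Triple k n = ℕ × Vec ℕ k × Vec ℕ n

canonicalTriples : ∀ k n → ℕ → List (Triple k n)
canonicalTriples k n zero = []
canonicalTriples k n (suc r) =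
  canonicalTriples k n r ++ cartesianProductWith (λ F H → r , F , H) (coverings 0 0 (suc r) k) (coverings 1 1 r n)

tripleMatrix : ∀ {k n} → Triple k n → Matrix01 k n
tripleMatrix (r , F , H) = thresholdMatrix (suc r) F H

∈-canonicalTriples⁻ : ∀ {k n} R {r F H} → (r , F , H) ∈ canonicalTriples k n R →
  r < R × F ∈ coverings 0 0 (suc r) k × H ∈ coverings 1 1 r n
∈-canonicalTriples⁻ {k} {n} (suc R) y∈ with ∈-++⁻ (canonicalTriples k n R) y∈
... | inj₁ y∈₁ with ∈-canonicalTriples⁻ R y∈₁
...   | r<R , F∈ , H∈ = m<n⇒m<1+n r<R , F∈ , H∈
∈-canonicalTriples⁻ {k} {n} (suc R) y∈ | inj₂ y∈₂
  with ∈-cartesianProductWith⁻ (λ F H → R , F , H) (coverings 0 0 (suc R) k) (coverings 1 1 R n) y∈₂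
... | F , H , F∈ , H∈ , refl = ≤-refl , F∈ , H∈

∈-canonicalTriples⁺ : ∀ {k n} R {r F H} → r < R → F ∈ coverings 0 0 (suc r) k → H ∈ coverings 1 1 r n →
  (r , F , H) ∈ canonicalTriples k n R
∈-canonicalTriples⁺ {k} {n} (suc R) {r} r<1+R F∈ H∈ with r ≟ R
... | yes refl = ∈-++⁺ʳ (canonicalTriples k n R) (∈-cartesianProductWith⁺ (λ F H → r , F , H) F∈ H∈)
... | no r≢R = ∈-++⁺ˡ (∈-canonicalTriples⁺ R (≤∧≢⇒< (≤-pred r<1+R) r≢R) F∈ H∈)

canonicalTriples-unique : ∀ k n R → Unique (canonicalTriples k n R)
canonicalTriples-unique k n zero = []
canonicalTriples-unique k n (suc R) = Unique.++⁺ (canonicalTriples-unique k n R)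
  (Unique.cartesianProductWith⁺ (λ F H → R , F , H) (λ { refl → refl , refl })
    (coverings-unique 0 0 (suc R) k) (coverings-unique 1 1 R n))
  (λ { (y∈₁ , y∈₂) → disjoint y∈₁ y∈₂ })
  where
  disjoint : ∀ {y} → y ∈ canonicalTriples k n R →
    ¬ y ∈ cartesianProductWith (λ F H → R , F , H) (coverings 0 0 (suc R) k) (coverings 1 1 R n)
  disjoint {r , F , H} y∈₁ y∈₂ with ∈-cartesianProductWith⁻ (λ F H → R , F , H) (coverings 0 0 (suc R) k) (coverings 1 1 R n) y∈₂
  ... | _ , _ , _ , _ , refl = <-irrefl refl (proj₁ (∈-canonicalTriples⁻ R y∈₁))

length-canonicalTriples : ∀ k n R → length (canonicalTriples k n R) ≡ Σ< R (λ r → coverCount 0 0 (suc r) k * coverCount 1 1 r n)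
length-canonicalTriples k n zero = refl
length-canonicalTriples k n (suc R) = trans (length-++ (canonicalTriples k n R)) (cong₂ _+_ (length-canonicalTriples k n R)
  (trans (length-cartesianProductWith _ (coverings 0 0 (suc R) k) (coverings 1 1 R n))
         (cong₂ _*_ (length-coverings 0 0 (suc R) k) (length-coverings 1 1 R n))))

tripleMatrix-injective : ∀ {k n} R {y y′ : Triple k n} → y ∈ canonicalTriples k n R → y′ ∈ canonicalTriples k n R →
  tripleMatrix y ≡ tripleMatrix y′ → y ≡ y′
tripleMatrix-injective R {r , F , H} {r′ , F′ , H′} y∈ y′∈ A≡A′
  with ∈-canonicalTriples⁻ R y∈ | ∈-canonicalTriples⁻ R y′∈
... | _ , F∈ , H∈ | _ , F′∈ , H′∈
  with thresholdMatrix-injective (coverings-sound 0 0 (suc r) _ F∈ , coverings-sound 1 1 r _ H∈)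
                                 (coverings-sound 0 0 (suc r′) _ F′∈ , coverings-sound 1 1 r′ _ H′∈) A≡A′
...   | refl , refl , refl = refl

L-formula : ∀ k n → L (suc k) n ≡ Σ< (suc k) (λ r → coverCount 0 0 (suc r) (suc k) * coverCount 1 1 r n)
L-formula k n = begin
  length (lonesumMatrices (suc k) n)
    ≡⟨ unique-⇔⇒length-≡ (lonesumMatrices-unique (suc k) n)
         (map-unique tripleMatrix (tripleMatrix-injective (suc k)) (canonicalTriples-unique (suc k) n (suc k))) (mk⇔ to from) ⟩
  length (List.map tripleMatrix (canonicalTriples (suc k) n (suc k)))
    ≡⟨ length-map tripleMatrix (canonicalTriples (suc k) n (suc k)) ⟩
  length (canonicalTriples (suc k) n (suc k))
    ≡⟨ length-canonicalTriples (suc k) n (suc k) ⟩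
  Σ< (suc k) (λ r → coverCount 0 0 (suc r) (suc k) * coverCount 1 1 r n) ∎
  where
  open ≡-Reasoning
  to : ∀ {A} → A ∈ lonesumMatrices (suc k) n → A ∈ List.map tripleMatrix (canonicalTriples (suc k) n (suc k))
  to A∈ with lonesum⇒canonical (suc k) _ (∈-lonesumMatrices⁻ A∈)
  ... | zero , F , H , _ , (covF , _) , _ = ⊥-elim (n≮0 (bounded covF zero))
  ... | suc r , F , H , c≤ , (covF , covH) , refl = ∈-map⁺ tripleMatrix
    (∈-canonicalTriples⁺ (suc k) c≤ (coverings-complete 0 0 (suc r) (suc k) F covF) (coverings-complete 1 1 r n H covH))
  from : ∀ {A} → A ∈ List.map tripleMatrix (canonicalTriples (suc k) n (suc k)) → A ∈ lonesumMatrices (suc k) n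
  from A∈ with ∈-map⁻ tripleMatrix A∈
  ... | (r , F , H) , _ , refl = ∈-lonesumMatrices⁺ (thresholdMatrix-lonesum (suc r) F H)

lookup-transpose : ∀ {A : Set} {k n} (X : Vec (Vec A n) k) j → lookup (transpose X) j ≡ Vec.map (λ row → lookup row j) X
lookup-transpose {n = n} [] j = lookup-replicate j []
lookup-transpose {A} {suc k} {n} (x ∷ X) j = begin
  lookup ((replicate n Vec._∷_ ⊛ x) ⊛ transpose X) j
    ≡⟨ lookup-⊛ j (replicate n Vec._∷_ ⊛ x) (transpose X) ⟩
  lookup (replicate n Vec._∷_ ⊛ x) j (lookup (transpose X) j)
    ≡⟨ cong (λ f → f (lookup (transpose X) j)) (lookup-⊛ j (replicate n Vec._∷_) x) ⟩
  lookup (replicate n (Vec._∷_ {A = A} {n = k})) j (lookup x j) (lookup (transpose X) j)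
    ≡⟨ cong (λ f → f (lookup x j) (lookup (transpose X) j)) (lookup-replicate j Vec._∷_) ⟩
  lookup x j ∷ lookup (transpose X) j
    ≡⟨ cong (lookup x j ∷_) (lookup-transpose X j) ⟩
  lookup x j ∷ Vec.map (λ row → lookup row j) X ∎
  where open ≡-Reasoning

transpose-involutive : ∀ {A : Set} {k n} (X : Vec (Vec A n) k) → transpose (transpose X) ≡ X
transpose-involutive X = vec-ext λ i → trans (lookup-transpose (transpose X) i) (vec-ext λ j → begin
  lookup (Vec.map (λ row → lookup row i) (transpose X)) j ≡⟨ lookup-map j (λ row → lookup row i) (transpose X) ⟩
  lookup (lookup (transpose X) j) i ≡⟨ cong (λ row → lookup row i) (lookup-transpose X j) ⟩
  lookup (Vec.map (λ row → lookup row j) X) i ≡⟨ lookup-map i (λ row → lookup row j) X ⟩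
  lookup (lookup X i) j ∎)
  where open ≡-Reasoning

lonesum-transpose : ∀ {k n} (A : Matrix01 k n) → Lonesum A → Lonesum (transpose A)
lonesum-transpose A lonesum B rowsB≡ colsB≡ = trans (sym (transpose-involutive B)) (cong transpose (lonesum (transpose B)
  (trans colsB≡ (cong (Vec.map vsum) (transpose-involutive A)))
  (trans (cong (Vec.map vsum) (transpose-involutive B)) rowsB≡)))

L-sym : ∀ k n → L k n ≡ L n k
L-sym k n = begin
  length (lonesumMatrices k n) ≡⟨ length-map transpose (lonesumMatrices k n) ⟨
  length (List.map transpose (lonesumMatrices k n))
    ≡⟨ unique-⇔⇒length-≡ (map-unique transpose (λ _ _ → transpose-injective) (lonesumMatrices-unique k n))
                          (lonesumMatrices-unique n k) (mk⇔ to from) ⟩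
  length (lonesumMatrices n k) ∎
  where
  open ≡-Reasoning
  transpose-injective : ∀ {X Y : Matrix01 k n} → transpose X ≡ transpose Y → X ≡ Y
  transpose-injective {X} {Y} eq = trans (sym (transpose-involutive X)) (trans (cong transpose eq) (transpose-involutive Y))
  to : ∀ {B} → B ∈ List.map transpose (lonesumMatrices k n) → B ∈ lonesumMatrices n k
  to B∈ with ∈-map⁻ transpose B∈
  ... | A , A∈ , refl = ∈-lonesumMatrices⁺ (lonesum-transpose A (∈-lonesumMatrices⁻ A∈))
  from : ∀ {B} → B ∈ lonesumMatrices n k → B ∈ List.map transpose (lonesumMatrices k n)
  from {B} B∈ = subst (_∈ List.map transpose (lonesumMatrices k n)) (transpose-involutive B)
    (∈-map⁺ transpose (∈-lonesumMatrices⁺ (lonesum-transpose B (∈-lonesumMatrices⁻ B∈))))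

-- Finite sums and a binomial identity

Σ<-cong : ∀ m {f g : ℕ → ℕ} → (∀ i → i < m → f i ≡ g i) → Σ< m f ≡ Σ< m g
Σ<-cong zero f≡g = refl
Σ<-cong (suc m) f≡g = cong₂ _+_ (Σ<-cong m (λ i i<m → f≡g i (m≤n⇒m≤1+n i<m))) (f≡g m ≤-refl)

Σ<-0 : ∀ m → Σ< m (λ _ → 0) ≡ 0
Σ<-0 zero = refl
Σ<-0 (suc m) = trans (+-identityʳ _) (Σ<-0 m)

Σ<-+ : ∀ m (f g : ℕ → ℕ) → Σ< m (λ i → f i + g i) ≡ Σ< m f + Σ< m g
Σ<-+ zero f g = refl
Σ<-+ (suc m) f g = trans (cong (_+ (f m + g m)) (Σ<-+ m f g)) (+-CS.interchange (Σ< m f) (Σ< m g) (f m) (g m))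

Σ<-*ˡ : ∀ m w (f : ℕ → ℕ) → Σ< m (λ i → w * f i) ≡ w * Σ< m f
Σ<-*ˡ zero w f = sym (*-zeroʳ w)
Σ<-*ˡ (suc m) w f = trans (cong (_+ w * f m) (Σ<-*ˡ m w f)) (sym (*-distribˡ-+ w (Σ< m f) (f m)))

Σ<-shift : ∀ m (f : ℕ → ℕ) → Σ< (suc m) f ≡ f 0 + Σ< m (λ i → f (suc i))
Σ<-shift zero f = +-comm 0 (f 0)
Σ<-shift (suc m) f = trans (cong (_+ f (suc m)) (Σ<-shift m f)) (+-assoc (f 0) _ _)

Σ<-swap : ∀ a b (f : ℕ → ℕ → ℕ) → Σ< a (λ i → Σ< b (f i)) ≡ Σ< b (λ j → Σ< a (λ i → f i j))
Σ<-swap zero b f = sym (Σ<-0 b)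
Σ<-swap (suc a) b f = trans (cong (_+ Σ< b (f a)) (Σ<-swap a b f)) (sym (Σ<-+ b (λ j → Σ< a (λ i → f i j)) (f a)))

Σ<-∣ : ∀ {d} m (f : ℕ → ℕ) → (∀ i → i < m → d ∣ f i) → d ∣ Σ< m f
Σ<-∣ zero f d∣f = _ ∣0
Σ<-∣ (suc m) f d∣f = ∣m∣n⇒∣m+n (Σ<-∣ m f (λ i i<m → d∣f i (m≤n⇒m≤1+n i<m))) (d∣f m ≤-refl)

C-absorption : ∀ r j → suc j * (r C suc j) + j * (r C j) ≡ r * (r C j)
C-absorption zero zero = cong (λ b → 1 * b + 0) (k>n⇒nCk≡0 {0} {1} (s≤s z≤n))
C-absorption zero (suc j) = trans
  (cong₂ (λ b b′ → suc (suc j) * b + suc j * b′) (k>n⇒nCk≡0 {0} {suc (suc j)} (s≤s z≤n)) (k>n⇒nCk≡0 {0} {suc j} (s≤s z≤n)))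
  (cong₂ _+_ (*-zeroʳ (suc (suc j))) (*-zeroʳ (suc j)))
C-absorption (suc r) zero = trans (+-identityʳ _) (trans (*-identityˡ _) (trans (nC1≡n (suc r)) (sym (*-identityʳ (suc r)))))
C-absorption (suc r) (suc j) = begin
  suc (suc j) * (suc r C suc (suc j)) + suc j * (suc r C suc j)
    ≡⟨ cong₂ (λ u v → suc (suc j) * u + suc j * v)
             (sym (nCk+nC[k+1]≡[n+1]C[k+1] r (suc j))) (sym (nCk+nC[k+1]≡[n+1]C[k+1] r j)) ⟩
  suc (suc j) * (b + b₁) + suc j * (b₀ + b)
    ≡⟨ by-ring j b₀ b b₁ ⟩
  (suc (suc j) * b₁ + suc j * b) + suc (suc j) * b + suc j * b₀
    ≡⟨ cong (λ z → z + suc (suc j) * b + suc j * b₀) (C-absorption r (suc j)) ⟩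
  r * b + suc (suc j) * b + suc j * b₀
    ≡⟨ by-ring′ j r b₀ b ⟩
  (suc j * b + j * b₀) + b₀ + r * b + b
    ≡⟨ cong (λ z → z + b₀ + r * b + b) (C-absorption r j) ⟩
  r * b₀ + b₀ + r * b + b
    ≡⟨ by-ring″ r b₀ b ⟩
  suc r * (b₀ + b)
    ≡⟨ cong (suc r *_) (nCk+nC[k+1]≡[n+1]C[k+1] r j) ⟩
  suc r * (suc r C suc j) ∎
  where
  open ≡-Reasoning
  b₀ b b₁ : ℕ
  b₀ = r C j
  b = r C suc j
  b₁ = r C suc (suc j)
  by-ring : ∀ j b₀ b b₁ →
    suc (suc j) * (b + b₁) + suc j * (b₀ + b) ≡ (suc (suc j) * b₁ + suc j * b) + suc (suc j) * b + suc j * b₀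
  by-ring = solve-∀
  by-ring′ : ∀ j r b₀ b → r * b + suc (suc j) * b + suc j * b₀ ≡ (suc j * b + j * b₀) + b₀ + r * b + b
  by-ring′ = solve-∀
  by-ring″ : ∀ r b₀ b → r * b₀ + b₀ + r * b + b ≡ suc r * (b₀ + b)
  by-ring″ = solve-∀

Σ<-freshHeadCount : ∀ r m →
  Σ< (suc r) (λ j → (r C j) * freshHeadCount 1 1 j m) ≡ Σ< (suc r) (λ j → suc j * (r C suc j) * coverCount 1 1 j m)
Σ<-freshHeadCount r m = begin
  Σ< (suc r) (λ j → (r C j) * freshHeadCount 1 1 j m)
    ≡⟨ Σ<-shift r (λ j → (r C j) * freshHeadCount 1 1 j m) ⟩
  Σ< r (λ j → (r C suc j) * (suc j * coverCount 1 1 j m))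
    ≡⟨ Σ<-cong r (λ j _ → *-CS.x∙yz≈yx∙z (r C suc j) (suc j) (coverCount 1 1 j m)) ⟩
  Σ< r (λ j → suc j * (r C suc j) * coverCount 1 1 j m)
    ≡⟨ +-identityʳ _ ⟨
  Σ< r (λ j → suc j * (r C suc j) * coverCount 1 1 j m) + 0
    ≡⟨ cong (Σ< r (λ j → suc j * (r C suc j) * coverCount 1 1 j m) +_) last-term≡0 ⟨
  Σ< (suc r) (λ j → suc j * (r C suc j) * coverCount 1 1 j m) ∎
  where
  open ≡-Reasoning
  last-term≡0 : suc r * (r C suc r) * coverCount 1 1 r m ≡ 0
  last-term≡0 = trans (cong (λ b → suc r * b * coverCount 1 1 r m) (k>n⇒nCk≡0 {r} {suc r} ≤-refl))
                      (cong (_* coverCount 1 1 r m) (*-zeroʳ (suc r)))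

absorb : ∀ r j g → (r C j) * ((2 + j) * g) + suc j * (r C suc j) * g ≡ (2 + r) * ((r C j) * g)
absorb r j g = begin
  (r C j) * ((2 + j) * g) + suc j * (r C suc j) * g ≡⟨ by-ring (r C j) (r C suc j) j g ⟩
  (2 * (r C j) + (suc j * (r C suc j) + j * (r C j))) * g ≡⟨ cong (λ z → (2 * (r C j) + z) * g) (C-absorption r j) ⟩
  (2 * (r C j) + r * (r C j)) * g ≡⟨ by-ring′ (r C j) r g ⟩
  (2 + r) * ((r C j) * g) ∎
  where
  open ≡-Reasoning
  by-ring : ∀ b b′ j g → b * ((2 + j) * g) + suc j * b′ * g ≡ (2 * b + (suc j * b′ + j * b)) * g
  by-ring = solve-∀
  by-ring′ : ∀ b r g → (2 * b + r * b) * g ≡ (2 + r) * (b * g)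
  by-ring′ = solve-∀

-- Classify the vectors in [0, r + 2)^m by the set of values in [1, r] that they take.
coverCount-1-1-binomial : ∀ r m → Σ< (suc r) (λ j → (r C j) * coverCount 1 1 j m) ≡ (2 + r) ^ m
coverCount-1-1-binomial r zero = begin
  Σ< (suc r) (λ j → (r C j) * coverCount 1 1 j 0) ≡⟨ Σ<-shift r (λ j → (r C j) * coverCount 1 1 j 0) ⟩
  1 + Σ< r (λ j → (r C suc j) * 0) ≡⟨ cong (1 +_) (trans (Σ<-cong r (λ j _ → *-zeroʳ (r C suc j))) (Σ<-0 r)) ⟩
  1 ∎
  where open ≡-Reasoning
coverCount-1-1-binomial r (suc m) = begin
  Σ< (suc r) (λ j → (r C j) * G j (suc m))
    ≡⟨ Σ<-cong (suc r) (λ j _ → *-distribˡ-+ (r C j) _ _) ⟩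
  Σ< (suc r) (λ j → (r C j) * ((2 + j) * G j m) + (r C j) * freshHeadCount 1 1 j m)
    ≡⟨ Σ<-+ (suc r) _ _ ⟩
  Σ< (suc r) (λ j → (r C j) * ((2 + j) * G j m)) + Σ< (suc r) (λ j → (r C j) * freshHeadCount 1 1 j m)
    ≡⟨ cong (Σ< (suc r) (λ j → (r C j) * ((2 + j) * G j m)) +_) (Σ<-freshHeadCount r m) ⟩
  Σ< (suc r) (λ j → (r C j) * ((2 + j) * G j m)) + Σ< (suc r) (λ j → suc j * (r C suc j) * G j m)
    ≡⟨ Σ<-+ (suc r) _ _ ⟨
  Σ< (suc r) (λ j → (r C j) * ((2 + j) * G j m) + suc j * (r C suc j) * G j m)
    ≡⟨ Σ<-cong (suc r) (λ j _ → absorb r j (G j m)) ⟩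
  Σ< (suc r) (λ j → (2 + r) * ((r C j) * G j m))
    ≡⟨ Σ<-*ˡ (suc r) (2 + r) _ ⟩
  (2 + r) * Σ< (suc r) (λ j → (r C j) * G j m)
    ≡⟨ cong ((2 + r) *_) (coverCount-1-1-binomial r m) ⟩
  (2 + r) ^ suc m ∎
  where
  open ≡-Reasoning
  G : ℕ → ℕ → ℕ
  G = coverCount 1 1

-- Euler's theorem

unique-⊆⇒length-≤ : ∀ {A : Set} {xs ys : List A} → Unique xs → (∀ {z} → z ∈ xs → z ∈ ys) → length xs ≤ length ys
unique-⊆⇒length-≤ {xs = []} _ _ = z≤n
unique-⊆⇒length-≤ {xs = x ∷ xs} {ys} (x∉xs ∷ xs!) xs⊆ys with ∈-∃++ (xs⊆ys (here refl))
... | zs₁ , zs₂ , refl = subst (suc (length xs) ≤_) (sym length-zs) (s≤s (unique-⊆⇒length-≤ xs! xs⊆zs))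
  where
  xs⊆zs : ∀ {z} → z ∈ xs → z ∈ zs₁ ++ zs₂
  xs⊆zs {z} z∈ with ∈-++⁻ zs₁ (xs⊆ys (there z∈))
  ... | inj₁ z∈₁ = ∈-++⁺ˡ z∈₁
  ... | inj₂ (here refl) = ⊥-elim (All.lookup x∉xs z∈ refl)
  ... | inj₂ (there z∈₂) = ∈-++⁺ʳ zs₁ z∈₂
  length-zs : length (zs₁ ++ x ∷ zs₂) ≡ suc (length (zs₁ ++ zs₂))
  length-zs = trans (length-++ zs₁) (trans (+-suc (length zs₁) (length zs₂)) (cong suc (sym (length-++ zs₁))))

unique-⊆-length⇒⊇ : ∀ {A : Set} → DecidableEquality A → ∀ {xs ys : List A} → Unique xs → (∀ {z} → z ∈ xs → z ∈ ys) →
  length ys ≤ length xs → ∀ {y} → y ∈ ys → y ∈ xs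
unique-⊆-length⇒⊇ _≟_ {xs} {ys} xs! xs⊆ys ys≤xs {y} y∈ys with y ∈? xs
  where open DecMembership _≟_ using (_∈?_)
... | yes y∈xs = y∈xs
... | no y∉xs = ⊥-elim (<-irrefl refl (≤-trans (unique-⊆⇒length-≤ y∷xs! y∷xs⊆ys) ys≤xs))
  where
  y∷xs! : Unique (y ∷ xs)
  y∷xs! = All.tabulate (λ z∈ y≡z → y∉xs (subst (_∈ xs) (sym y≡z) z∈)) ∷ xs!
  y∷xs⊆ys : ∀ {z} → z ∈ y ∷ xs → z ∈ ys
  y∷xs⊆ys (here refl) = y∈ys
  y∷xs⊆ys (there z∈) = xs⊆ys z∈

module _ {M : ℕ} .{{_ : NonZero M}} where

  %-≡⇒∣∸ : ∀ x y → x % M ≡ y % M → y ≤ x → M ∣ x ∸ y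
  %-≡⇒∣∸ x y x≡y y≤x = divides (x / M ∸ y / M) (begin
    x ∸ y ≡⟨ cong₂ _∸_ (m≡m%n+[m/n]*n x M) (m≡m%n+[m/n]*n y M) ⟩
    (x % M + x / M * M) ∸ (y % M + y / M * M) ≡⟨ cong (λ r → (x % M + x / M * M) ∸ (r + y / M * M)) x≡y ⟨
    (x % M + x / M * M) ∸ (x % M + y / M * M) ≡⟨ [m+n]∸[m+o]≡n∸o (x % M) _ _ ⟩
    x / M * M ∸ y / M * M ≡⟨ *-distribʳ-∸ M (x / M) (y / M) ⟨
    (x / M ∸ y / M) * M ∎)
    where open ≡-Reasoning

  ∣∸⇒%-≡ : ∀ x y → M ∣ x ∸ y → y ≤ x → x % M ≡ y % M
  ∣∸⇒%-≡ x y (divides q x∸y≡) y≤x = begin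
    x % M ≡⟨ cong (_% M) (m+[n∸m]≡n y≤x) ⟨
    (y + (x ∸ y)) % M ≡⟨ cong (λ z → (y + z) % M) x∸y≡ ⟩
    (y + q * M) % M ≡⟨ [m+kn]%n≡m%n y q M ⟩
    y % M ∎
    where open ≡-Reasoning

  ∣-cancel-coprime : ∀ {P} x y → Coprime P M → (x * P) % M ≡ (y * P) % M → y ≤ x → M ∣ x ∸ y
  ∣-cancel-coprime {P} x y P⊥M xP≡yP y≤x = coprime-divisor (Coprimality.sym P⊥M)
    (subst (M ∣_) (trans (sym (*-distribʳ-∸ P x y)) (*-comm (x ∸ y) P)) (%-≡⇒∣∸ (x * P) (y * P) xP≡yP (*-monoˡ-≤ P y≤x)))

  %-cancel-coprime : ∀ {P} x y → Coprime P M → (x * P) % M ≡ (y * P) % M → x % M ≡ y % M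
  %-cancel-coprime x y P⊥M xP≡yP with ≤-total y x
  ... | inj₁ y≤x = ∣∸⇒%-≡ x y (∣-cancel-coprime x y P⊥M xP≡yP y≤x) y≤x
  ... | inj₂ x≤y = sym (∣∸⇒%-≡ y x (∣-cancel-coprime y x P⊥M (sym xP≡yP) x≤y) x≤y)

  ^-cong-% : ∀ x y k → x % M ≡ y % M → (x ^ k) % M ≡ (y ^ k) % M
  ^-cong-% x y zero _ = refl
  ^-cong-% x y (suc k) x≡y = begin
    (x * x ^ k) % M ≡⟨ %-distribˡ-* x (x ^ k) M ⟩
    ((x % M) * ((x ^ k) % M)) % M ≡⟨ cong₂ (λ u v → (u * v) % M) x≡y (^-cong-% x y k x≡y) ⟩
    ((y % M) * ((y ^ k) % M)) % M ≡⟨ %-distribˡ-* y (y ^ k) M ⟨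
    (y * y ^ k) % M ∎
    where open ≡-Reasoning

coprime-* : ∀ {a b M} → Coprime a M → Coprime b M → Coprime (a * b) M
coprime-* {a} {b} {M} a⊥M b⊥M {d} (d∣ab , d∣M) = b⊥M (coprime-divisor d⊥a d∣ab , d∣M)
  where
  d⊥a : Coprime d a
  d⊥a (e∣d , e∣a) = a⊥M (e∣a , ∣-trans e∣d d∣M)

coprime-^ : ∀ {d a} → Coprime d a → ∀ k → Coprime d (a ^ k)
coprime-^ d⊥a zero (_ , e∣1) = ∣1⇒≡1 e∣1
coprime-^ d⊥a (suc k) = Coprimality.sym (coprime-* (Coprimality.sym d⊥a) (Coprimality.sym (coprime-^ d⊥a k)))

coprime-product : ∀ {M} (xs : List ℕ) → All.All (λ x → Coprime x M) xs → Coprime (product xs) M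
coprime-product [] _ (d∣1 , _) = ∣1⇒≡1 d∣1
coprime-product (x ∷ xs) (x⊥M All.∷ xs⊥M) = coprime-* x⊥M (coprime-product xs xs⊥M)

coprime-% : ∀ {x M} .{{_ : NonZero M}} → Coprime x M → Coprime (x % M) M
coprime-% x⊥M (d∣x%M , d∣M) = x⊥M (∣n∣m%n⇒∣m d∣M d∣x%M , d∣M)

-- x ↦ b x mod M permutes the residues coprime to M, so their product P satisfies b ^ φ M * P ≡ P
-- modulo M, and P can be cancelled.
module _ (M : ℕ) .{{_ : NonZero M}} {b : ℕ} (b⊥M : Coprime b M) where

  private
    units : List ℕ
    units = filter (λ i → gcd i M ≟ 1) (upTo M)

    ∈-units⁻ : ∀ {x} → x ∈ units → x < M × Coprime x M
    ∈-units⁻ x∈ with ∈-filter⁻ (λ i → gcd i M ≟ 1) {xs = upTo M} x∈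
    ... | x∈upTo , gcd≡1 = ∈-upTo⁻ x∈upTo , gcd≡1⇒coprime gcd≡1

    ∈-units⁺ : ∀ {x} → x < M → Coprime x M → x ∈ units
    ∈-units⁺ x<M x⊥M = ∈-filter⁺ (λ i → gcd i M ≟ 1) (∈-upTo⁺ x<M) (coprime⇒gcd≡1 x⊥M)

    units-unique : Unique units
    units-unique = Unique.filter⁺ (λ i → gcd i M ≟ 1) (Unique.upTo⁺ M)

    scale : ℕ → ℕ
    scale x = (b * x) % M

    scale-injective : ∀ {x y} → x ∈ units → y ∈ units → scale x ≡ scale y → x ≡ y
    scale-injective {x} {y} x∈ y∈ bx≡by = begin
      x ≡⟨ m<n⇒m%n≡m (proj₁ (∈-units⁻ x∈)) ⟨
      x % M ≡⟨ %-cancel-coprime x y b⊥M (subst₂ (λ u v → u % M ≡ v % M) (*-comm b x) (*-comm b y) bx≡by) ⟩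
      y % M ≡⟨ m<n⇒m%n≡m (proj₁ (∈-units⁻ y∈)) ⟩
      y ∎
      where open ≡-Reasoning

    scaled-units-unique : Unique (List.map scale units)
    scaled-units-unique = map-unique scale scale-injective units-unique

    scaled⊆units : ∀ {z} → z ∈ List.map scale units → z ∈ units
    scaled⊆units z∈ with ∈-map⁻ scale z∈
    ... | x , x∈ , refl = ∈-units⁺ (m%n<n (b * x) M) (coprime-% (coprime-* b⊥M (proj₂ (∈-units⁻ x∈))))

    units⊆scaled : ∀ {z} → z ∈ units → z ∈ List.map scale units
    units⊆scaled = unique-⊆-length⇒⊇ _≟_ scaled-units-unique scaled⊆units (≤-reflexive (sym (length-map scale units)))

    product-map-scale : ∀ xs → product (List.map scale xs) % M ≡ (b ^ length xs * product xs) % M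
    product-map-scale [] = refl
    product-map-scale (x ∷ xs) = begin
      (scale x * product (List.map scale xs)) % M ≡⟨ %-distribˡ-* (scale x) _ M ⟩
      ((scale x % M) * (product (List.map scale xs) % M)) % M
        ≡⟨ cong₂ (λ u v → (u * v) % M) (m%n%n≡m%n (b * x) M) (product-map-scale xs) ⟩
      (((b * x) % M) * ((b ^ length xs * product xs) % M)) % M ≡⟨ %-distribˡ-* (b * x) _ M ⟨
      (b * x * (b ^ length xs * product xs)) % M ≡⟨ cong (_% M) (*-CS.interchange b x (b ^ length xs) (product xs)) ⟩
      (b * b ^ length xs * (x * product xs)) % M ∎
      where open ≡-Reasoning

  euler : (b ^ φ M) % M ≡ 1 % M
  euler = %-cancel-coprime (b ^ φ M) 1 (coprime-product units (All.tabulate (λ x∈ → proj₂ (∈-units⁻ x∈)))) (begin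
    (b ^ φ M * product units) % M ≡⟨ product-map-scale units ⟨
    product (List.map scale units) % M
      ≡⟨ cong (_% M) (product-↭ (∼bag⇒↭ (unique∧set⇒bag scaled-units-unique units-unique
                                                        (mk⇔ scaled⊆units units⊆scaled)))) ⟩
    product units % M ≡⟨ cong (_% M) (*-identityˡ (product units)) ⟨
    (1 * product units) % M ∎)
    where open ≡-Reasoning

^-monoˡ-∣ : ∀ {p q} k → p ∣ q → p ^ k ∣ q ^ k
^-monoˡ-∣ zero _ = ∣-refl
^-monoˡ-∣ (suc k) p∣q = *-pres-∣ p∣q (^-monoˡ-∣ k p∣q)

prime-divisor : ∀ q → 2 ≤ q → ∃ λ p → Prime p × p ∣ q
prime-divisor (suc zero) (s≤s ())
prime-divisor q@(suc (suc _)) _ with factorise q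
... | record { factors = [] ; isFactorisation = () }
... | record { factors = p ∷ ps ; isFactorisation = q≡ ; factorsPrime = p-prime All.∷ _ } =
  p , p-prime , divides (product ps) (trans q≡ (*-comm p (product ps)))

-- Divide M by gcd (M , a) n times.  The removed part divides a ^ n, and the remaining part is coprime
-- to a as soon as no p ^ (n + 1) divides M: a common divisor q of the remaining part and a divides
-- each of the first n + 1 gcds, so q ^ (n + 1) ∣ M.
module CoprimeSplit (M a : ℕ) where

  remaining : ℕ → ℕ
  remaining zero = M
  remaining (suc i) = quotient (gcd[m,n]∣m (remaining i) a)

  removed : ℕ → ℕ
  removed zero = 1
  removed (suc i) = gcd (remaining i) a * removed i

  M≡remaining*removed : ∀ i → M ≡ remaining i * removed i
  M≡remaining*removed zero = sym (*-identityʳ M)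
  M≡remaining*removed (suc i) = begin
    M ≡⟨ M≡remaining*removed i ⟩
    remaining i * removed i ≡⟨ cong (_* removed i) (m∣n⇒n≡quotient*m (gcd[m,n]∣m (remaining i) a)) ⟩
    remaining (suc i) * gcd (remaining i) a * removed i ≡⟨ *-assoc (remaining (suc i)) _ _ ⟩
    remaining (suc i) * removed (suc i) ∎
    where open ≡-Reasoning

  removed∣a^ : ∀ i → removed i ∣ a ^ i
  removed∣a^ zero = ∣-refl
  removed∣a^ (suc i) = *-pres-∣ (gcd[m,n]∣n (remaining i) a) (removed∣a^ i)

  removed∣M : ∀ i → removed i ∣ M
  removed∣M i = divides (remaining i) (M≡remaining*removed i)

  remaining-anti : ∀ i j → i ≤ j → remaining j ∣ remaining i
  remaining-anti i j i≤j with ≤⇒≤′ i≤j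
  ... | ≤′-refl = ∣-refl
  ... | ≤′-step {n = j′} i≤′j′ = ∣-trans (quotient-∣ (gcd[m,n]∣m (remaining j′) a)) (remaining-anti i j′ (≤′⇒≤ i≤′j′))

  remaining-coprime : ∀ n → 1 ≤ a → (∀ p e → Prime p → p ^ e ∣ M → e ≤ n) → Coprime (remaining n) a
  remaining-coprime n 1≤a exponents≤n = gcd≡1⇒coprime q≡1
    where
    q : ℕ
    q = gcd (remaining n) a
    q∣gcd : ∀ i → i ≤ n → q ∣ gcd (remaining i) a
    q∣gcd i i≤n = gcd-greatest (∣-trans (gcd[m,n]∣m (remaining n) a) (remaining-anti i n i≤n)) (gcd[m,n]∣n (remaining n) a)
    q^∣removed : ∀ i → i ≤ suc n → q ^ i ∣ removed i
    q^∣removed zero _ = ∣-refl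
    q^∣removed (suc i) 1+i≤1+n = *-pres-∣ (q∣gcd i (≤-pred 1+i≤1+n)) (q^∣removed i (m≤n⇒m≤1+n (≤-pred 1+i≤1+n)))
    q≡1 : q ≡ 1
    q≡1 with q in q≡
    ... | zero = ⊥-elim (gcd[m,n]≢0 (remaining n) a (inj₂ (λ a≡0 → <-irrefl (sym a≡0) 1≤a)) q≡)
    ... | suc zero = refl
    ... | suc (suc q′) with prime-divisor (suc (suc q′)) (s≤s (s≤s z≤n))
    ...   | p , p-prime , p∣q = ⊥-elim (<-irrefl refl (exponents≤n p (suc n) p-prime
            (∣-trans (^-monoˡ-∣ (suc n) (subst (p ∣_) (sym q≡) p∣q)) (∣-trans (q^∣removed (suc n) ≤-refl) (removed∣M (suc n))))))

coprime-shift : ∀ {M M′ D a n} → M ≡ M′ * D → D ∣ a ^ n → Coprime M′ a → Coprime (a + M′) M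
coprime-shift {M} {M′} {D} {a} {n} M≡M′*D D∣a^n M′⊥a {d} (d∣a+M′ , d∣M) = coprime-^ d⊥a n (∣-refl , ∣-trans d∣D D∣a^n)
  where
  d⊥M′ : Coprime d M′
  d⊥M′ {e} (e∣d , e∣M′) = M′⊥a (e∣M′ , ∣m+n∣m⇒∣n (subst (e ∣_) (+-comm a M′) (∣-trans e∣d d∣a+M′)) e∣M′)
  d∣D : d ∣ D
  d∣D = coprime-divisor d⊥M′ (subst (d ∣_) M≡M′*D d∣M)
  d⊥a : Coprime d a
  d⊥a (e∣d , e∣a) = M′⊥a (∣m+n∣m⇒∣n (∣-trans e∣d d∣a+M′) e∣a , e∣a)

-- Euler's theorem for a + M′, reduced modulo M′.
euler-divisor : ∀ {M M′ a} .{{_ : NonZero M}} .{{_ : NonZero M′}} → M′ ∣ M → Coprime (a + M′) M → 1 ≤ a →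
  M′ ∣ a ^ φ M ∸ 1
euler-divisor {M} {M′} {a} M′∣M a+M′⊥M 1≤a = %-≡⇒∣∸ (a ^ φ M) 1 (begin
  (a ^ φ M) % M′ ≡⟨ ^-cong-% (a + M′) a (φ M) ([m+n]%n≡m%n a M′) ⟨
  ((a + M′) ^ φ M) % M′ ≡⟨ m∣n⇒o%n%m≡o%m M′ M _ M′∣M ⟨
  ((a + M′) ^ φ M) % M % M′ ≡⟨ cong (_% M′) (euler M a+M′⊥M) ⟩
  1 % M % M′ ≡⟨ m∣n⇒o%n%m≡o%m M′ M 1 M′∣M ⟩
  1 % M′ ∎) (subst (_≤ a ^ φ M) (^-zeroˡ (φ M)) (^-monoˡ-≤ (φ M) 1≤a))
  where open ≡-Reasoning

-- Split M = M′ D with D ∣ a ^ n and M′ coprime to a, so that M′ ∣ a ^ φ M - 1.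
euler-generalised : ∀ M n → 1 ≤ M → (∀ p e → Prime p → p ^ e ∣ M → e ≤ n) → ∀ a → M ∣ a ^ (n + φ M) ∸ a ^ n
euler-generalised M n _ exponents≤n zero = subst (M ∣_) (sym (m≤n⇒m∸n≡0 (0^[n+k]≤0^n n (φ M)))) (M ∣0)
  where
  0^[n+k]≤0^n : ∀ n k → 0 ^ (n + k) ≤ 0 ^ n
  0^[n+k]≤0^n zero zero = ≤-refl
  0^[n+k]≤0^n zero (suc k) = z≤n
  0^[n+k]≤0^n (suc n) k = ≤-refl
euler-generalised M@(suc _) n _ exponents≤n a@(suc _) = subst (M ∣_) a^n*[a^φ-1]≡
  (subst (_∣ a ^ n * (a ^ φ M ∸ 1)) (trans (*-comm D M′) (sym M≡M′*D))
    (*-pres-∣ (removed∣a^ n) (euler-divisor (divides D (trans M≡M′*D (*-comm M′ D)))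
      (coprime-shift {n = n} M≡M′*D (removed∣a^ n) (remaining-coprime n (s≤s z≤n) exponents≤n)) (s≤s z≤n))))
  where
  open CoprimeSplit M a
  M′ D : ℕ
  M′ = remaining n
  D = removed n
  M≡M′*D : M ≡ M′ * D
  M≡M′*D = M≡remaining*removed n
  instance
    M′≢0 : NonZero M′
    M′≢0 = ≢-nonZero λ M′≡0 → 1+n≢0 (trans M≡M′*D (cong (_* D) M′≡0))
  a^n*[a^φ-1]≡ : a ^ n * (a ^ φ M ∸ 1) ≡ a ^ (n + φ M) ∸ a ^ n
  a^n*[a^φ-1]≡ = trans (*-distribˡ-∸ (a ^ n) (a ^ φ M) 1) (cong₂ _∸_ (sym (^-distribˡ-+-* a n (φ M))) (*-identityʳ (a ^ n)))

-- Window sums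

factorial-∣-coverCount-0-0 : ∀ c k → c ! ∣ coverCount 0 0 c k
factorial-∣-coverCount-0-0 zero zero = ∣-refl
factorial-∣-coverCount-0-0 (suc c) zero = _ ∣0
factorial-∣-coverCount-0-0 zero (suc k) = _ ∣0
factorial-∣-coverCount-0-0 (suc c) (suc k) = ∣m∣n⇒∣m+n
  (∣-trans (factorial-∣-coverCount-0-0 (suc c) k) (n∣m*n (suc c)))
  (*-monoʳ-∣ (suc c) (factorial-∣-coverCount-0-0 c k))

geometric-sum : ∀ d n m → Σ< m (λ i → d * suc d ^ (n + i)) + suc d ^ n ≡ suc d ^ (n + m)
geometric-sum d n zero = cong (suc d ^_) (sym (+-identityʳ n))
geometric-sum d n (suc m) = begin
  Σ< m (λ i → d * suc d ^ (n + i)) + d * suc d ^ (n + m) + suc d ^ n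
    ≡⟨ +-CS.xy∙z≈xz∙y (Σ< m (λ i → d * suc d ^ (n + i))) _ _ ⟩
  Σ< m (λ i → d * suc d ^ (n + i)) + suc d ^ n + d * suc d ^ (n + m)
    ≡⟨ cong (_+ d * suc d ^ (n + m)) (geometric-sum d n m) ⟩
  suc d ^ (n + m) + d * suc d ^ (n + m)
    ≡⟨ cong (suc d ^_) (+-suc n m) ⟨
  suc d ^ (n + suc m) ∎
  where open ≡-Reasoning

binomial-split : ∀ r c m → Σ< r (λ j → (r C j) * (c * coverCount 1 1 j m)) + c * coverCount 1 1 r m ≡ c * (2 + r) ^ m
binomial-split r c m = begin
  Σ< r (λ j → (r C j) * (c * G j m)) + c * G r m
    ≡⟨ cong₂ _+_ (Σ<-cong r (λ j _ → *-CS.x∙yz≈y∙xz (r C j) c (G j m)))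
                 (cong (c *_) (sym (trans (cong (_* G r m) (nCn≡1 r)) (*-identityˡ (G r m))))) ⟩
  Σ< r (λ j → c * ((r C j) * G j m)) + c * ((r C r) * G r m)
    ≡⟨ cong (_+ c * ((r C r) * G r m)) (Σ<-*ˡ r c (λ j → (r C j) * G j m)) ⟩
  c * Σ< r (λ j → (r C j) * G j m) + c * ((r C r) * G r m)
    ≡⟨ *-distribˡ-+ c _ _ ⟨
  c * Σ< (suc r) (λ j → (r C j) * G j m)
    ≡⟨ cong (c *_) (coverCount-1-1-binomial r m) ⟩
  c * (2 + r) ^ m ∎
  where
  open ≡-Reasoning
  G : ℕ → ℕ → ℕ
  G = coverCount 1 1

module WindowSums (M n : ℕ) (1≤M : 1 ≤ M) (exponents≤n : ∀ p e → Prime p → p ^ e ∣ M → e ≤ n) where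

  WindowDivisible : (ℕ → ℕ) → Set
  WindowDivisible h = M ∣ Σ< (φ M) (λ i → h (n + i))

  windowDivisible-cong : ∀ {f g} → (∀ m → f m ≡ g m) → WindowDivisible f → WindowDivisible g
  windowDivisible-cong f≡g = subst (M ∣_) (Σ<-cong (φ M) (λ i _ → f≡g (n + i)))

  windowDivisible-* : ∀ c f → WindowDivisible f → WindowDivisible (λ m → c * f m)
  windowDivisible-* c f M∣ = subst (M ∣_) (sym (Σ<-*ˡ (φ M) c (λ i → f (n + i)))) (∣-trans M∣ (n∣m*n c))

  windowDivisible-cancelˡ : ∀ f g → WindowDivisible (λ m → f m + g m) → WindowDivisible f → WindowDivisible g
  windowDivisible-cancelˡ f g M∣ M∣f =
    ∣m+n∣m⇒∣n (subst (M ∣_) (Σ<-+ (φ M) (λ i → f (n + i)) (λ i → g (n + i))) M∣) M∣f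

  windowDivisible-Σ : ∀ r (f : ℕ → ℕ → ℕ) → (∀ j → j < r → WindowDivisible (f j)) →
    WindowDivisible (λ m → Σ< r (λ j → f j m))
  windowDivisible-Σ r f M∣ = subst (M ∣_) (sym (Σ<-swap (φ M) r (λ i j → f j (n + i)))) (Σ<-∣ r _ M∣)

  windowDivisible-geometric : ∀ d → WindowDivisible (λ m → d * suc d ^ m)
  windowDivisible-geometric d = subst (M ∣_) window≡ (euler-generalised M n 1≤M exponents≤n (suc d))
    where
    window≡ : suc d ^ (n + φ M) ∸ suc d ^ n ≡ Σ< (φ M) (λ i → d * suc d ^ (n + i))
    window≡ = trans (cong (_∸ suc d ^ n) (sym (geometric-sum d n (φ M)))) (m+n∸n≡m _ (suc d ^ n))

  -- Strong induction on r, inverting coverCount-1-1-binomial: c G r is c (r + 2) ^ m, a multiple of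
  -- (r + 1) (r + 2) ^ m, minus the terms C(r, j) c G j with j < r.
  windowDivisible-coverCount : ∀ r c → suc r ! ∣ c → WindowDivisible (λ m → c * coverCount 1 1 r m)
  windowDivisible-coverCount = <-rec _ step
    where
    step : ∀ r → (∀ {j} → j < r → ∀ c → suc j ! ∣ c → WindowDivisible (λ m → c * coverCount 1 1 j m)) →
           ∀ c → suc r ! ∣ c → WindowDivisible (λ m → c * coverCount 1 1 r m)
    step r ih c r+1!∣c with ∣-trans (m∣m*n (r !)) r+1!∣c
    ... | divides w c≡w*[r+1] = windowDivisible-cancelˡ lowerTerms (λ m → c * G r m)
            (windowDivisible-cong (λ m → sym (binomial-split r c m)) full) lower
      where
      G : ℕ → ℕ → ℕ
      G = coverCount 1 1
      lowerTerms : ℕ → ℕ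
      lowerTerms m = Σ< r (λ j → (r C j) * (c * G j m))
      lower : WindowDivisible lowerTerms
      lower = windowDivisible-Σ r (λ j m → (r C j) * (c * G j m)) λ j j<r →
        windowDivisible-* (r C j) (λ m → c * G j m) (ih j<r c (∣-trans (m≤n⇒m!∣n! (s≤s (<⇒≤ j<r))) r+1!∣c))
      full : WindowDivisible (λ m → c * (2 + r) ^ m)
      full = windowDivisible-cong (λ m → trans (sym (*-assoc w (suc r) _)) (cong (_* (2 + r) ^ m) (sym c≡w*[r+1])))
        (windowDivisible-* w (λ m → suc r * (2 + r) ^ m) (windowDivisible-geometric (suc r)))

  windowDivisible-L : ∀ k → WindowDivisible (L (suc k))
  windowDivisible-L k = windowDivisible-cong (λ m → sym (L-formula k m))
    (windowDivisible-Σ (suc k) (λ r m → coverCount 0 0 (suc r) (suc k) * coverCount 1 1 r m)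
    (λ r _ → windowDivisible-coverCount r _ (factorial-∣-coverCount-0-0 (suc r) (suc k))))

theorem3p8 : (k M n : ℕ) → 1 ≤ k → 1 ≤ M →
    (∀ (p e : ℕ) → Prime p → p ^ e ∣ M → e ≤ n) →
    (M ∣ Σ< (φ M) (λ i → L k (n + i))) × (M ∣ Σ< (φ M) (λ i → L (n + i) k))
theorem3p8 (suc k) M n _ 1≤M exponents≤n =
  windowDivisible-L k , windowDivisible-cong (L-sym (suc k)) (windowDivisible-L k)
  where open WindowSums M n 1≤M exponents≤n
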